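{- Let $\mathcal{F}$ be the free non-symmetric operad on two binary generators $\alpha,\beta$, and let $\pi:\mathcal{F}\to\mathrm{CNCB}$ be the operad morphism with $\pi(\alpha)=\tau_{aaa}$ and $\pi(\beta)=\tau_{abb}$. Then $\pi$ induces an isomorphism from $\mathcal{F}/_{\equiv}$ onto the suboperad $\langle\tau_{aaa},\tau_{abb}\rangle$, where $\equiv$ is the smallest operad congruence of $\mathcal{F}$ containing $(\beta\circ_2\alpha)\circ_3\beta\equiv(\beta\circ_1\beta)\circ_2\alpha$ and $(\alpha\circ_2\beta)\circ_3\alpha\equiv(\alpha\circ_1\beta)\circ_2\alpha$.
   Context: A bicoloured noncrossing configuration (BNC) of size $n\ge2$ is a regular polygon with vertices $1,\dots,n+1$ (clockwise) with each arc $(i,j)$, $1\le i<j\le n+1$, coloured blue, red or uncoloured, such that no two coloured (blue or red) arcs cross and red arcs are diagonals. The edges are $(i,i+1)$ for $i\in[n]$ (the $i$-th edge), the base is $(1,n+1)$, and the other arcs are diagonals. There is also a unique BNC of size $1$, a single blue arc (its edge and base). $\mathrm{CNCB}$ is the non-symmetric operad of BNCs (arity = size, unit = the size-$1$ BNC) with composition $\mathfrak{C}\circ_i\mathfrak{D}$ ($\mathfrak{C}$ of size $n$, $\mathfrak{D}$ of size $m$) obtained by gluing the base of $\mathfrak{D}$ onto the $i$-th edge of $\mathfrak{C}$. Vertex $j$ of $\mathfrak{C}$ goes to $j$ if $j\le i$ and to $j+m-1$ otherwise, and vertex $\ell$ of $\mathfrak{D}$ goes to $i+\ell-1$. All other arcs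 keep their colours. The arc $(i,i+m)$ is red if the $i$-th edge of $\mathfrak{C}$ and the base of $\mathfrak{D}$ are both uncoloured, blue if both are blue, and uncoloured otherwise. All remaining arcs are uncoloured. For $x,y,z\in\{a,b\}$, $\tau_{xyz}$ is the BNC of size $2$ (a triangle, which has no diagonals) whose first edge $(1,2)$, base $(1,3)$ and second edge $(2,3)$ are respectively coloured $x,y,z$, where $a$ means blue and $b$ means uncoloured. $\langle G\rangle$ denotes the smallest suboperad of $\mathrm{CNCB}$ containing $G$. -}

module Defs where

open import Data.Nat using (ℕ; zero; suc; _+_; _∸_; _<_; _≤_; _≤ᵇ_; _≡ᵇ_)
open import Data.Bool using (Bool; true; false; if_then_else_; _∧_; _∨_)
open import Data.Product using (_×_; Σ; _,_)
open import Data.Empty using (⊥)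
open import Relation.Binary.PropositionalEquality using (_≡_; _≢_)
open import Relation.Nullary using (¬_)

-- Conventions: vertices of a BNC of size n are 0,1,…,n (paper vertex v+1
-- is our vertex v).  The k-th edge (0-based,
-- k < n) is (k,k+1) (= paper's (k+1)-th edge), the base is (0,n).

data Colour : Set where
  blue red none : Colour

-- A (possibly ill-formed) coloured polygon: size and colour of each arc.
-- Only values col p q with p < q ≤ size are meaningful.
record BNC : Set where
  constructor mkBNC
  field
    size : ℕ
    col  : ℕ → ℕ → Colour
open BNC public

_≈_ : BNC → BNC → Set
C ≈ D = (size C ≡ size D) × (∀ p q → p < q → q ≤ size C → col C p q ≡ col D p q)

IsBNC : BNC → Set
IsBNC C =
  (1 ≤ size C)
  × (size C ≡ 1 → col C 0 1 ≡ blue)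
  × (2 ≤ size C →
       (∀ p q → p < q → q ≤ size C → col C p q ≡ red →
          (q ≢ suc p) × ¬ (p ≡ 0 × q ≡ size C))
     × (∀ p q p' q' → p < p' → p' < q → q < q' → q' ≤ size C →
          col C p q ≢ none → col C p' q' ≢ none → ⊥))

glue : Colour → Colour → Colour
glue none none = red
glue blue blue = blue
glue _    _    = none

unitB : BNC
unitB = mkBNC 1 c
  where
  c : ℕ → ℕ → Colour
  c 0 1 = blue
  c _ _ = none

-- operadic composition  C ∘⟨ k ⟩ D  : glue the base of D on the k-th edge
-- (0-based k, i.e. the paper's ∘_{k+1})
_∘⟨_⟩_ : BNC → ℕ → BNC → BNC
C ∘⟨ k ⟩ D = mkBNC (size C + size D ∸ 1) c
  where
  m = size D
  inD : ℕ → Bool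
  inD v = (k ≤ᵇ v) ∧ (v ≤ᵇ k + m)
  inC : ℕ → Bool
  inC v = (v ≤ᵇ k) ∨ (k + m ≤ᵇ v)
  back : ℕ → ℕ
  back v = if v ≤ᵇ k then v else v ∸ (m ∸ 1)
  c : ℕ → ℕ → Colour
  c p q =
    if inD p ∧ inD q
    then (if (p ≡ᵇ k) ∧ (q ≡ᵇ k + m)
          then glue (col C k (suc k)) (col D 0 m)
          else col D (p ∸ k) (q ∸ k))
    else (if inC p ∧ inC q then col C (back p) (back q) else none)

-- τ_{xyz}: triangle with first edge x, base y, second edge z
τ : Colour → Colour → Colour → BNC
τ x y z = mkBNC 2 c
  where
  c : ℕ → ℕ → Colour
  c 0 1 = x
  c 0 2 = y
  c 1 2 = z
  c _ _ = none

τaaa τabb : BNC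
τaaa = τ blue blue blue
τabb = τ blue none none

data InGen : BNC → Set where
  gen-unit : InGen unitB
  gen-aaa  : InGen τaaa
  gen-abb  : InGen τabb
  gen-comp : ∀ {C D} k → k < size C → InGen C → InGen D → InGen (C ∘⟨ k ⟩ D)

-- The free non-symmetric operad on two binary generators α, β:
-- planar binary trees with internal nodes labelled α or β.

data Gen : Set where
  α β : Gen

data Tree : Set where
  leaf : Tree
  node : Gen → Tree → Tree → Tree

arity : Tree → ℕ
arity leaf = 1
arity (node _ l r) = arity l + arity r

gt : Gen → Tree
gt g = node g leaf leaf

-- partial composition s ∘_{k+1} t (graft t on the k-th leaf, 0-based)
graft : Tree → ℕ → Tree → Tree
graft leaf zero t = t
graft leaf (suc _) t = leaf
graft (node g l r) k t =
  if suc k ≤ᵇ arity l then node g (graft l k t) r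
  else node g l (graft r (k ∸ arity l) t)

data _≡F_ : Tree → Tree → Set where
  cg-refl  : ∀ {s} → s ≡F s
  cg-sym   : ∀ {s t} → s ≡F t → t ≡F s
  cg-trans : ∀ {s t u} → s ≡F t → t ≡F u → s ≡F u
  cg-comp  : ∀ {s s' t t'} k → k < arity s → s ≡F s' → t ≡F t' →
             graft s k t ≡F graft s' k t'
  -- (β ∘₂ α) ∘₃ β ≡ (β ∘₁ β) ∘₂ α
  cg-rel₁  : graft (graft (gt β) 1 (gt α)) 2 (gt β)
               ≡F graft (graft (gt β) 0 (gt β)) 1 (gt α)
  -- (α ∘₂ β) ∘₃ α ≡ (α ∘₁ β) ∘₂ α
  cg-rel₂  : graft (graft (gt α) 1 (gt β)) 2 (gt α)
               ≡F graft (graft (gt α) 0 (gt β)) 1 (gt α)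

πg : Gen → BNC
πg α = τaaa
πg β = τabb

-- node g l r = (g ∘₁ l) ∘_{arity l + 1} r
π : Tree → BNC
π leaf = unitB
π (node g l r) = ((πg g) ∘⟨ 0 ⟩ (π l)) ∘⟨ arity l ⟩ (π r)

-- π respects grafting because composition in CNCB is associative, both sequentially and in parallel;
-- hence ≡-related trees have the same image and the image of π is exactly ⟨τaaa, τabb⟩.  For injectivity,
-- both relations are oriented as g(β(X, α(Y, Z)), W) ⟶ g(X, g′(Y, g(Z, W))), g′ the other generator, so
-- every tree is ≡ to a normal form: one in which no left child has the shape β(X, α(Y, Z)).  A normal form
-- is recovered from its image.  The root is read off the colour of the base.  The arity a of the left
-- subtree is the least split point: a vertex crossed by no coloured arc but the base, whose arc to the
-- next such vertex is blue or ends at the last vertex.  Below a, the left subtree being normal forces the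
-- arcs between consecutive such vertices to be uncoloured or red.
module Submission where

open import Defs
open import Data.Bool using (true; false)
open import Data.Bool.Properties using (¬-not; T-≡; ∧-zeroʳ)
open import Data.Empty using (⊥; ⊥-elim)
open import Data.List using (_∷_; [])
open import Data.Nat
open import Data.Nat.Properties
open import Algebra.Properties.CommutativeSemigroup +-commutativeSemigroup using (xy∙z≈xz∙y)
open import Data.Nat.Tactic.RingSolver using (solve)
open import Data.Product using (_×_; Σ; _,_; proj₁; proj₂)
open import Data.Sum using (_⊎_; inj₁; inj₂; map₁; map₂)
open import Function using (_∘_)
open import Function.Bundles using (Equivalence)
open import Level using (0ℓ)
open import Relation.Binary.Bundles using (Setoid)
open import Relation.Binary.Definitions using (tri<; tri≈; tri>)
open import Relation.Binary.PropositionalEquality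
open import Relation.Nullary using (¬_; yes; no; Dec)
open import Relation.Nullary.Decidable using (True; toWitness; _×-dec_)
import Relation.Binary.Reasoning.Setoid

≤ᵇ-true : ∀ {m n} → m ≤ n → (m ≤ᵇ n) ≡ true
≤ᵇ-true m≤n = Equivalence.to T-≡ (≤⇒≤ᵇ m≤n)

≤ᵇ-false : ∀ {m n} → n < m → (m ≤ᵇ n) ≡ false
≤ᵇ-false {m} {n} n<m = ¬-not λ e → <⇒≱ n<m (≤ᵇ⇒≤ m n (Equivalence.from T-≡ e))

≡ᵇ-true : ∀ {m n} → m ≡ n → (m ≡ᵇ n) ≡ true
≡ᵇ-true {m} {n} m≡n = Equivalence.to T-≡ (≡⇒≡ᵇ m n m≡n)

≡ᵇ-false : ∀ {m n} → m ≢ n → (m ≡ᵇ n) ≡ false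
≡ᵇ-false {m} {n} m≢n = ¬-not λ e → m≢n (≡ᵇ⇒≡ m n (Equivalence.from T-≡ e))

m+n≤o⇒n≤o∸m : ∀ {m n o} → m + n ≤ o → n ≤ o ∸ m
m+n≤o⇒n≤o∸m {m} {n} {o} h = m+n≤o⇒m≤o∸n n (subst (_≤ o) (+-comm m n) h)

m+n<o⇒n<o∸m : ∀ {m n o} → m + n < o → n < o ∸ m
m+n<o⇒n<o∸m {m} {n} {o} h = m+n≤o⇒n≤o∸m {m} (subst (_≤ o) (sym (+-suc m n)) h)

n≤m⇒m<n+o⇒m∸n<o : ∀ {m n o} → n ≤ m → m < n + o → m ∸ n < o
n≤m⇒m<n+o⇒m∸n<o {m} {n} {o} n≤m h = +-cancelˡ-< n (m ∸ n) o (subst (_< n + o) (sym (m+[n∸m]≡n n≤m)) h)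

n≤m⇒m∸n≡o⇒m≡n+o : ∀ {m n o} → n ≤ m → m ∸ n ≡ o → m ≡ n + o
n≤m⇒m∸n≡o⇒m≡n+o n≤m refl = sym (m+[n∸m]≡n n≤m)

m∸n≤o⇒m≤n+o : ∀ {m n o} → m ∸ n ≤ o → m ≤ n + o
m∸n≤o⇒m≤n+o {m} {n} h = ≤-trans (m≤n+m∸n m n) (+-monoʳ-≤ n h)

m∸n<o⇒m<n+o : ∀ {m n o} → m ∸ n < o → m < n + o
m∸n<o⇒m<n+o {m} {n} h = ≤-<-trans (m≤n+m∸n m n) (+-monoʳ-< n h)

o<m∸n⇒n+o<m : ∀ {m n o} → o < m ∸ n → n + o < m
o<m∸n⇒n+o<m {m} {n} {o} h = subst (n + o <_) (m+[n∸m]≡n n≤m) (+-monoʳ-< n h)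
  where
  n≤m : n ≤ m
  n≤m = <⇒≤ (m∸n≢0⇒n<m λ m∸n≡0 → n≮0 (subst (o <_) m∸n≡0 h))

n≤m⇒o≤m∸n⇒n+o≤m : ∀ {m n o} → n ≤ m → o ≤ m ∸ n → n + o ≤ m
n≤m⇒o≤m∸n⇒n+o≤m {m} {n} {o} n≤m h = subst (n + o ≤_) (m+[n∸m]≡n n≤m) (+-monoʳ-≤ n h)

m∸n∸o≡m∸o∸n : ∀ m n o → m ∸ n ∸ o ≡ m ∸ o ∸ n
m∸n∸o≡m∸o∸n m n o = begin
  m ∸ n ∸ o   ≡⟨ ∸-+-assoc m n o ⟩
  m ∸ (n + o) ≡⟨ cong (m ∸_) (+-comm n o) ⟩
  m ∸ (o + n) ≡⟨ ∸-+-assoc m o n ⟨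
  m ∸ o ∸ n   ∎
  where open ≡-Reasoning

-- Position of an arc (p, q) of C ∘⟨ k ⟩ D relative to the copy of D, which
-- occupies the vertices k, …, k + m.  The cases overlap but cover everything.
data ArcPosition (k m p q : ℕ) : Set where
  before   : q ≤ k → ArcPosition k m p q
  inside   : k ≤ p → q ≤ k + m → ¬ (p ≡ k × q ≡ k + m) → ArcPosition k m p q
  glued    : p ≡ k → q ≡ k + m → ArcPosition k m p q
  after    : k + m ≤ p → ArcPosition k m p q
  around   : p ≤ k → k + m ≤ q → ¬ (p ≡ k × q ≡ k + m) → ArcPosition k m p q
  crossesˡ : p < k → k < q → q < k + m → ArcPosition k m p q
  crossesʳ : k < p → p < k + m → k + m < q → ArcPosition k m p q

arcPosition : ∀ k m p q → ArcPosition k m p q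
arcPosition k m p q with q ≤? k
... | yes q≤k = before q≤k
... | no q≰k with p <? k
...   | yes p<k with q <? k + m
...     | yes q<k+m = crossesˡ p<k (≰⇒> q≰k) q<k+m
...     | no q≮k+m = around (<⇒≤ p<k) (≮⇒≥ q≮k+m) (λ (p≡k , _) → <-irrefl p≡k p<k)
arcPosition k m p q | no q≰k | no p≮k with k + m ≤? p
... | yes k+m≤p = after k+m≤p
... | no k+m≰p with q ≤? k + m | p ≟ k
...   | yes q≤k+m | no p≢k = inside (≮⇒≥ p≮k) q≤k+m (λ (p≡k , _) → p≢k p≡k)
...   | yes q≤k+m | yes p≡k with q ≟ k + m
...     | yes q≡k+m = glued p≡k q≡k+m
...     | no q≢k+m = inside (≮⇒≥ p≮k) q≤k+m (λ (_ , q≡k+m) → q≢k+m q≡k+m)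
arcPosition k m p q | no q≰k | no p≮k | no k+m≰p | no q≰k+m | yes p≡k =
  around (≤-reflexive p≡k) (<⇒≤ (≰⇒> q≰k+m)) (λ (_ , q≡k+m) → q≰k+m (≤-reflexive q≡k+m))
arcPosition k m p q | no q≰k | no p≮k | no k+m≰p | no q≰k+m | no p≢k =
  crossesʳ (≤∧≢⇒< (≮⇒≥ p≮k) (p≢k ∘ sym)) (≰⇒> k+m≰p) (≰⇒> q≰k+m)


module ∘-Colour (C D : BNC) (k : ℕ) (0<m : 0 < size D) where
  private
    m = size D
    k<k+m : k < k + m
    k<k+m = m<m+n k 0<m

  col-∘-before : ∀ {p q} → p < q → q ≤ k → col (C ∘⟨ k ⟩ D) p q ≡ col C p q
  col-∘-before {p} {q} p<q q≤k
    rewrite ≤ᵇ-false {k} {p} (<-≤-trans p<q q≤k) | ≤ᵇ-true (≤-trans (<⇒≤ p<q) q≤k)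
          | ≤ᵇ-true q≤k = refl

  col-∘-inside : ∀ {p q} → p < q → k ≤ p → q ≤ k + m → ¬ (p ≡ k × q ≡ k + m) →
                 col (C ∘⟨ k ⟩ D) p q ≡ col D (p ∸ k) (q ∸ k)
  col-∘-inside {p} {q} p<q k≤p q≤k+m not-base
    rewrite ≤ᵇ-true k≤p | ≤ᵇ-true (≤-trans (<⇒≤ p<q) q≤k+m)
          | ≤ᵇ-true (≤-trans k≤p (<⇒≤ p<q)) | ≤ᵇ-true q≤k+m
    with p ≟ k
  ... | no p≢k rewrite ≡ᵇ-false p≢k = refl
  ... | yes p≡k rewrite ≡ᵇ-true p≡k | ≡ᵇ-false {q} {k + m} (λ q≡k+m → not-base (p≡k , q≡k+m)) = refl

  col-∘-glued : ∀ {p q} → p ≡ k → q ≡ k + m →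
                col (C ∘⟨ k ⟩ D) p q ≡ glue (col C k (suc k)) (col D 0 m)
  col-∘-glued refl refl
    rewrite ≤ᵇ-true (≤-refl {k}) | ≤ᵇ-true (m≤m+n k m) | ≤ᵇ-true (≤-refl {k + m})
          | ≡ᵇ-true (refl {x = k}) | ≡ᵇ-true (refl {x = k + m}) = refl

  col-∘-after : ∀ {p q} → p < q → k + m ≤ p →
                col (C ∘⟨ k ⟩ D) p q ≡ col C (p ∸ (m ∸ 1)) (q ∸ (m ∸ 1))
  col-∘-after {p} {q} p<q k+m≤p
    rewrite ≤ᵇ-true (≤-trans (m≤m+n k m) k+m≤p) | ≤ᵇ-true (≤-trans (m≤m+n k m) (≤-trans k+m≤p (<⇒≤ p<q)))
          | ≤ᵇ-false {q} {k + m} (≤-<-trans k+m≤p p<q) | ∧-zeroʳ (p ≤ᵇ k + m)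
          | ≤ᵇ-false {p} {k} (<-≤-trans k<k+m k+m≤p) | ≤ᵇ-true k+m≤p
          | ≤ᵇ-true (≤-trans k+m≤p (<⇒≤ p<q))
          | ≤ᵇ-false {q} {k} (<-≤-trans k<k+m (≤-trans k+m≤p (<⇒≤ p<q))) = refl

  col-∘-around : ∀ {p q} → p ≤ k → k + m ≤ q → ¬ (p ≡ k × q ≡ k + m) →
                 col (C ∘⟨ k ⟩ D) p q ≡ col C p (q ∸ (m ∸ 1))
  col-∘-around {p} {q} p≤k k+m≤q not-base with p ≟ k
  ... | no p≢k
    rewrite ≤ᵇ-false {k} {p} (≤∧≢⇒< p≤k p≢k) | ≤ᵇ-true p≤k
          | ≤ᵇ-false {q} {k} (<-≤-trans k<k+m k+m≤q) | ≤ᵇ-true k+m≤q = refl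
  ... | yes refl
    rewrite ≤ᵇ-true (≤-refl {k}) | ≤ᵇ-true (m≤m+n k m) | ≤ᵇ-true (≤-trans (m≤m+n k m) k+m≤q)
          | ≤ᵇ-false {q} {k + m} (≤∧≢⇒< k+m≤q (λ k+m≡q → not-base (refl , sym k+m≡q)))
          | ≤ᵇ-false {q} {k} (<-≤-trans k<k+m k+m≤q) | ≤ᵇ-true k+m≤q = refl

  col-∘-crossesˡ : ∀ {p q} → p < k → k < q → q < k + m → col (C ∘⟨ k ⟩ D) p q ≡ none
  col-∘-crossesˡ {p} {q} p<k k<q q<k+m
    rewrite ≤ᵇ-false {k} {p} p<k | ≤ᵇ-true (<⇒≤ p<k) | ≤ᵇ-false {q} {k} k<q
          | ≤ᵇ-false {k + m} {q} q<k+m = refl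

  col-∘-crossesʳ : ∀ {p q} → k < p → p < k + m → k + m < q → col (C ∘⟨ k ⟩ D) p q ≡ none
  col-∘-crossesʳ {p} {q} k<p p<k+m k+m<q
    rewrite ≤ᵇ-true (<⇒≤ k<p) | ≤ᵇ-true (<⇒≤ p<k+m)
          | ≤ᵇ-true (<⇒≤ (<-trans k<p (<-trans p<k+m k+m<q)))
          | ≤ᵇ-false {q} {k + m} k+m<q | ≤ᵇ-false {p} {k} k<p | ≤ᵇ-false {k + m} {p} p<k+m = refl

Colouring : Set
Colouring = ℕ → ℕ → Colour

Agree : ℕ → Colouring → Colouring → Set
Agree n c c′ = ∀ p q → p < q → q ≤ n → c p q ≡ c′ p q

≈-refl : ∀ {C} → C ≈ C
≈-refl = refl , λ _ _ _ _ → refl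

≈-reflexive : ∀ {C D} → C ≡ D → C ≈ D
≈-reflexive refl = ≈-refl

≈-sym : ∀ {C D} → C ≈ D → D ≈ C
≈-sym (s≡ , f) = sym s≡ , λ p q p<q q≤ → sym (f p q p<q (≤-trans q≤ (≤-reflexive (sym s≡))))

≈-trans : ∀ {C D E} → C ≈ D → D ≈ E → C ≈ E
≈-trans (s≡ , f) (s≡′ , g) =
  trans s≡ s≡′ , λ p q p<q q≤ → trans (f p q p<q q≤) (g p q p<q (≤-trans q≤ (≤-reflexive s≡)))

m+[1+n]∸1≡m+n : ∀ m n → m + suc n ∸ 1 ≡ m + n
m+[1+n]∸1≡m+n m n = cong (_∸ 1) (+-suc m n)

∘-cong : ∀ {C C′ D D′} k → C ≈ C′ → D ≈ D′ → k < size C → 0 < size D →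
         (C ∘⟨ k ⟩ D) ≈ (C′ ∘⟨ k ⟩ D′)
∘-cong {D = mkBNC zero _} _ _ _ _ ()
∘-cong {C} {C′} {D@(mkBNC (suc m) cD)} {D′@(mkBNC _ cD′)} k (sC≡ , fC) (refl , fD) k<n _ =
  cong (λ n → n + suc m ∸ 1) sC≡ , agree
  where
  n = size C
  module L = ∘-Colour C D k z<s
  module R = ∘-Colour C′ D′ k z<s
  shifted≤ : ∀ {q} → q ≤ n + suc m ∸ 1 → q ∸ m ≤ n
  shifted≤ {q} h = m≤n+o⇒m∸n≤o q m (subst (q ≤_) (trans (m+[1+n]∸1≡m+n n m) (+-comm n m)) h)
  agree : Agree (n + suc m ∸ 1) (col (C ∘⟨ k ⟩ D)) (col (C′ ∘⟨ k ⟩ D′))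
  agree p q p<q q≤ with arcPosition k (suc m) p q
  ... | before q≤k = trans (L.col-∘-before p<q q≤k)
          (trans (fC p q p<q (≤-trans q≤k (<⇒≤ k<n))) (sym (R.col-∘-before p<q q≤k)))
  ... | inside k≤p q≤ nb = trans (L.col-∘-inside p<q k≤p q≤ nb)
          (trans (fD _ _ (∸-monoˡ-< p<q k≤p) (m≤n+o⇒m∸n≤o q k q≤)) (sym (R.col-∘-inside p<q k≤p q≤ nb)))
  ... | glued p≡k q≡ = trans (L.col-∘-glued p≡k q≡)
          (trans (cong₂ glue (fC k (suc k) (n<1+n k) k<n) (fD 0 (suc m) z<s ≤-refl)) (sym (R.col-∘-glued p≡k q≡)))
  ... | after k+m≤p = trans (L.col-∘-after p<q k+m≤p)
          (trans (fC _ _ (∸-monoˡ-< p<q m≤p) (shifted≤ q≤)) (sym (R.col-∘-after p<q k+m≤p)))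
    where
    m≤p : m ≤ p
    m≤p = ≤-trans (m≤n+m m (suc k)) (subst (_≤ p) (+-suc k m) k+m≤p)
  ... | around p≤k k+m≤q nb = trans (L.col-∘-around p≤k k+m≤q nb)
          (trans (fC _ _ p<q′ (shifted≤ q≤)) (sym (R.col-∘-around p≤k k+m≤q nb)))
    where
    p<q′ : p < q ∸ m
    p<q′ = ≤-<-trans p≤k (m+n<o⇒n<o∸m {m} (subst (_≤ q) (trans (+-suc k m) (cong suc (+-comm k m))) k+m≤q))
  ... | crossesˡ p<k k<q q< = trans (L.col-∘-crossesˡ p<k k<q q<) (sym (R.col-∘-crossesˡ p<k k<q q<))
  ... | crossesʳ k<p p< <q = trans (L.col-∘-crossesʳ k<p p< <q) (sym (R.col-∘-crossesʳ k<p p< <q))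

∘-congˡ : ∀ C {D D′} k → D ≈ D′ → k < size C → 0 < size D → (C ∘⟨ k ⟩ D) ≈ (C ∘⟨ k ⟩ D′)
∘-congˡ C k = ∘-cong {C} {C} k ≈-refl

∘-congʳ : ∀ {C C′} D k → C ≈ C′ → k < size C → 0 < size D → (C ∘⟨ k ⟩ D) ≈ (C′ ∘⟨ k ⟩ D)
∘-congʳ D k C≈C′ = ∘-cong {D = D} {D} k C≈C′ ≈-refl

GlueAssoc : Colour → Colour → Colour → Set
GlueAssoc x y z = glue (glue x y) z ≡ glue x (glue y z)

module SeqAssoc (C : BNC) (m l : ℕ) (cD cE : Colouring) (i j : ℕ) (j≤m : j ≤ m) where
  D = mkBNC (suc m) cD
  E = mkBNC (suc l) cE
  X = C ∘⟨ i ⟩ D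
  Y = D ∘⟨ j ⟩ E

  LHS RHS : Colouring
  LHS = col (X ∘⟨ i + j ⟩ E)
  RHS = col (C ∘⟨ i ⟩ Y)

  end : ℕ
  end = i + j + suc l

  private
    module CD = ∘-Colour C D i z<s
    module DE = ∘-Colour D E j z<s
    module L = ∘-Colour X E (i + j) z<s
    module R = ∘-Colour C Y i (≤-trans z<s (m≤n+m (suc l) m))

    i+j<i+1+m : i + j < i + suc m
    i+j<i+1+m = +-monoʳ-< i (s≤s j≤m)

    i+j<i+|Y| : i + j < i + (m + suc l)
    i+j<i+|Y| = +-monoʳ-< i (≤-trans (s≤s j≤m) (subst (suc m ≤_) (sym (+-suc m l)) (s≤s (m≤m+n m l))))

    end≤i+|Y| : end ≤ i + (m + suc l)
    end≤i+|Y| = subst (_≤ i + (m + suc l)) (sym (+-assoc i j (suc l))) (+-monoʳ-≤ i (+-monoˡ-≤ (suc l) j≤m))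

    end≡ : i + j + suc l ≡ suc (l + (i + j))
    end≡ = solve (i ∷ j ∷ l ∷ [])

    shift-i+|Y| : l + (i + suc m) ≡ i + (m + suc l)
    shift-i+|Y| = solve (l ∷ i ∷ m ∷ [])

    end∸i : ∀ {q} → end ≤ q → j + suc l ≤ q ∸ i
    end∸i {q} h = m+n≤o⇒n≤o∸m {i} (subst (_≤ q) (+-assoc i j (suc l)) h)

    ∸|Y|∸1 : ∀ p → p ∸ (m + suc l ∸ 1) ≡ p ∸ l ∸ m
    ∸|Y|∸1 p = trans (cong (p ∸_) (trans (cong (_∸ 1) (+-suc m l)) (+-comm m l))) (sym (∸-+-assoc p l m))

    ≤i+|Y| : ∀ {q} → q ∸ l ≤ i + suc m → q ≤ i + (m + suc l)
    ≤i+|Y| {q} h = subst (q ≤_) shift-i+|Y| (m∸n≤o⇒m≤n+o {q} {l} h)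

    not-base-Y : ∀ {p q} → ¬ (p ≡ i × q ∸ l ≡ i + suc m) → ¬ (p ≡ i × q ≡ i + (m + suc l))
    not-base-Y nb (p≡i , q≡) = nb (p≡i , trans (cong (_∸ l) (trans q≡ (sym shift-i+|Y|))) (m+n∸m≡n l _))

  before-E : ∀ {p q} → p < q → q ≤ i + j → LHS p q ≡ RHS p q
  before-E {p} {q} p<q q≤i+j with arcPosition i (suc m) p q
  ... | before q≤i =
    trans (L.col-∘-before p<q q≤i+j) (trans (CD.col-∘-before p<q q≤i) (sym (R.col-∘-before p<q q≤i)))
  ... | inside i≤p q≤ nb = trans (L.col-∘-before p<q q≤i+j) (trans (CD.col-∘-inside p<q i≤p q≤ nb)
          (sym (trans (R.col-∘-inside p<q i≤p (≤-trans q≤i+j (<⇒≤ i+j<i+|Y|))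
                         (λ (_ , q≡) → <⇒≱ (≤-<-trans q≤i+j i+j<i+|Y|) (≤-reflexive (sym q≡))))
                      (DE.col-∘-before (∸-monoˡ-< p<q i≤p) (m≤n+o⇒m∸n≤o q i q≤i+j)))))
  ... | glued _ q≡ = ⊥-elim (<⇒≱ (≤-<-trans q≤i+j i+j<i+1+m) (≤-reflexive (sym q≡)))
  ... | after ≤p = ⊥-elim (<⇒≱ (<-trans (<-≤-trans p<q q≤i+j) i+j<i+1+m) ≤p)
  ... | around _ ≤q _ = ⊥-elim (<⇒≱ (≤-<-trans q≤i+j i+j<i+1+m) ≤q)
  ... | crossesʳ _ _ <q = ⊥-elim (<⇒≱ (≤-<-trans q≤i+j i+j<i+1+m) (<⇒≤ <q))
  ... | crossesˡ p<i i<q q< = trans (L.col-∘-before p<q q≤i+j)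
          (trans (CD.col-∘-crossesˡ p<i i<q q<) (sym (R.col-∘-crossesˡ p<i i<q (≤-<-trans q≤i+j i+j<i+|Y|))))

  inside-E : ∀ {p q} → p < q → i + j ≤ p → q ≤ end → ¬ (p ≡ i + j × q ≡ end) → LHS p q ≡ RHS p q
  inside-E {p} {q} p<q i+j≤p q≤end nb = begin
    LHS p q                       ≡⟨ L.col-∘-inside p<q i+j≤p q≤end nb ⟩
    cE (p ∸ (i + j)) (q ∸ (i + j)) ≡⟨ cong₂ cE (∸-+-assoc p i j) (∸-+-assoc q i j) ⟨
    cE (p ∸ i ∸ j) (q ∸ i ∸ j)     ≡⟨ DE.col-∘-inside (∸-monoˡ-< p<q i≤p) (m+n≤o⇒n≤o∸m i+j≤p)
                                        (m≤n+o⇒m∸n≤o q i (subst (q ≤_) (+-assoc i j (suc l)) q≤end)) nb-Y ⟨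
    col Y (p ∸ i) (q ∸ i)          ≡⟨ R.col-∘-inside p<q i≤p (≤-trans q≤end end≤i+|Y|) nb-C ⟨
    RHS p q                        ∎
    where
    open ≡-Reasoning
    i≤p : i ≤ p
    i≤p = ≤-trans (m≤m+n i j) i+j≤p
    nb-C : ¬ (p ≡ i × q ≡ i + (m + suc l))
    nb-C (p≡i , q≡) = nb (≤-antisym (≤-trans (≤-reflexive p≡i) (m≤m+n i j)) i+j≤p ,
                          ≤-antisym q≤end (≤-trans end≤i+|Y| (≤-reflexive (sym q≡))))
    nb-Y : ¬ (p ∸ i ≡ j × q ∸ i ≡ j + suc l)
    nb-Y (p∸i≡j , q∸i≡) = nb (n≤m⇒m∸n≡o⇒m≡n+o i≤p p∸i≡j , q≡end q∸i≡)
      where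
      q≡end : q ∸ i ≡ j + suc l → q ≡ end
      q≡end h = trans (n≤m⇒m∸n≡o⇒m≡n+o (≤-trans i≤p (<⇒≤ p<q)) h) (sym (+-assoc i j (suc l)))

  after-E : ∀ {p q} → p < q → end ≤ p → LHS p q ≡ RHS p q
  after-E {p} {q} p<q end≤p =
    trans (L.col-∘-after p<q end≤p) (go (arcPosition i (suc m) (p ∸ l) (q ∸ l)))
    where
    l+i+j<p : l + (i + j) < p
    l+i+j<p = subst (_≤ p) end≡ end≤p
    l≤p : l ≤ p
    l≤p = ≤-trans (m≤m+n l (i + j)) (<⇒≤ l+i+j<p)
    p<q′ : p ∸ l < q ∸ l
    p<q′ = ∸-monoˡ-< p<q l≤p
    i<p′ : i < p ∸ l
    i<p′ = ≤-<-trans (m≤m+n i j) (m+n<o⇒n<o∸m {l} l+i+j<p)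
    i≤p : i ≤ p
    i≤p = ≤-trans (<⇒≤ i<p′) (m∸n≤m p l)
    nb-C : ¬ (p ≡ i × q ≡ i + (m + suc l))
    nb-C (p≡i , _) = <-irrefl (sym p≡i) (<-≤-trans i<p′ (m∸n≤m p l))
    go : ArcPosition i (suc m) (p ∸ l) (q ∸ l) → col X (p ∸ l) (q ∸ l) ≡ RHS p q
    go (before q′≤i) = ⊥-elim (<⇒≱ (≤-<-trans q′≤i i<p′) (<⇒≤ p<q′))
    go (inside i≤p′ q′≤ nb) = begin
      col X (p ∸ l) (q ∸ l)   ≡⟨ CD.col-∘-inside p<q′ i≤p′ q′≤ nb ⟩
      cD (p ∸ l ∸ i) (q ∸ l ∸ i) ≡⟨ cong₂ cD (m∸n∸o≡m∸o∸n p l i) (m∸n∸o≡m∸o∸n q l i) ⟩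
      cD (p ∸ i ∸ l) (q ∸ i ∸ l) ≡⟨ DE.col-∘-after (∸-monoˡ-< p<q i≤p) (end∸i end≤p) ⟨
      col Y (p ∸ i) (q ∸ i)    ≡⟨ R.col-∘-inside p<q i≤p (≤i+|Y| q′≤) nb-C ⟨
      RHS p q                  ∎
      where open ≡-Reasoning
    go (glued p′≡i _) = ⊥-elim (<-irrefl (sym p′≡i) i<p′)
    go (after ≤p′) = begin
      col X (p ∸ l) (q ∸ l)         ≡⟨ CD.col-∘-after p<q′ ≤p′ ⟩
      col C (p ∸ l ∸ m) (q ∸ l ∸ m) ≡⟨ cong₂ (col C) (∸|Y|∸1 p) (∸|Y|∸1 q) ⟨
      col C (p ∸ (m + suc l ∸ 1)) (q ∸ (m + suc l ∸ 1))
        ≡⟨ R.col-∘-after p<q (subst (_≤ p) shift-i+|Y| (n≤m⇒o≤m∸n⇒n+o≤m l≤p ≤p′)) ⟨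
      RHS p q                       ∎
      where open ≡-Reasoning
    go (around p′≤i _ _) = ⊥-elim (<⇒≱ i<p′ p′≤i)
    go (crossesˡ p′<i _ _) = ⊥-elim (<⇒≱ i<p′ (<⇒≤ p′<i))
    go (crossesʳ i<p′′ p′< <q′) = trans (CD.col-∘-crossesʳ i<p′′ p′< <q′)
      (sym (R.col-∘-crossesʳ (<-≤-trans i<p′ (m∸n≤m p l))
                             (subst (p <_) shift-i+|Y| (m∸n<o⇒m<n+o {p} {l} p′<))
                             (subst (_< q) shift-i+|Y| (o<m∸n⇒n+o<m {q} {l} <q′))))

  around-E : ∀ {p q} → p < q → p ≤ i + j → end ≤ q → ¬ (p ≡ i + j × q ≡ end) → LHS p q ≡ RHS p q
  around-E {p} {q} p<q p≤i+j end≤q nb =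
    trans (L.col-∘-around p≤i+j end≤q nb) (go (arcPosition i (suc m) p (q ∸ l)))
    where
    l+i+j<q : l + (i + j) < q
    l+i+j<q = subst (_≤ q) end≡ end≤q
    l≤q : l ≤ q
    l≤q = ≤-trans (m≤m+n l (i + j)) (<⇒≤ l+i+j<q)
    i+j<q′ : i + j < q ∸ l
    i+j<q′ = m+n<o⇒n<o∸m {l} l+i+j<q
    i<q′ : i < q ∸ l
    i<q′ = ≤-<-trans (m≤m+n i j) i+j<q′
    p<q′ : p < q ∸ l
    p<q′ = ≤-<-trans p≤i+j i+j<q′
    go : ArcPosition i (suc m) p (q ∸ l) → col X p (q ∸ l) ≡ RHS p q
    go (before q′≤i) = ⊥-elim (<⇒≱ i<q′ q′≤i)
    go (inside i≤p q′≤ nb′) = begin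
      col X p (q ∸ l)     ≡⟨ CD.col-∘-inside p<q′ i≤p q′≤ nb′ ⟩
      cD (p ∸ i) (q ∸ l ∸ i) ≡⟨ cong (cD (p ∸ i)) (m∸n∸o≡m∸o∸n q l i) ⟩
      cD (p ∸ i) (q ∸ i ∸ l) ≡⟨ DE.col-∘-around (m≤n+o⇒m∸n≤o p i p≤i+j) (end∸i end≤q) nb-Y ⟨
      col Y (p ∸ i) (q ∸ i)  ≡⟨ R.col-∘-inside p<q i≤p (≤i+|Y| q′≤) (not-base-Y nb′) ⟨
      RHS p q                ∎
      where
      open ≡-Reasoning
      nb-Y : ¬ (p ∸ i ≡ j × q ∸ i ≡ j + suc l)
      nb-Y (p∸i≡j , q∸i≡) = nb (n≤m⇒m∸n≡o⇒m≡n+o i≤p p∸i≡j , q≡end q∸i≡)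
        where
        q≡end : q ∸ i ≡ j + suc l → q ≡ end
        q≡end h = trans (n≤m⇒m∸n≡o⇒m≡n+o (≤-trans i≤p (<⇒≤ p<q)) h) (sym (+-assoc i j (suc l)))
    go (glued p≡i q′≡) = begin
      col X p (q ∸ l)                              ≡⟨ CD.col-∘-glued p≡i q′≡ ⟩
      glue (col C i (suc i)) (cD 0 (suc m))        ≡⟨ cong (glue (col C i (suc i))) (trans e base-Y) ⟩
      glue (col C i (suc i)) (col Y 0 (m + suc l)) ≡⟨ R.col-∘-glued p≡i q≡ ⟨
      RHS p q                                      ∎
      where
      open ≡-Reasoning
      q≡ : q ≡ i + (m + suc l)
      q≡ = trans (n≤m⇒m∸n≡o⇒m≡n+o l≤q q′≡) shift-i+|Y|
      e : cD 0 (suc m) ≡ cD 0 (m + suc l ∸ l)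
      e = cong (cD 0) (sym (trans (cong (_∸ l) (+-suc m l)) (m+n∸n≡m (suc m) l)))
      nb-Y : ¬ (0 ≡ j × m + suc l ≡ j + suc l)
      nb-Y (0≡j , ≡j+1+l) = nb (trans p≡i (sym (trans (cong (i +_) (sym 0≡j)) (+-identityʳ i))) ,
                                trans q≡ (trans (cong (i +_) ≡j+1+l) (sym (+-assoc i j (suc l)))))
      base-Y : cD 0 (m + suc l ∸ l) ≡ col Y 0 (m + suc l)
      base-Y = sym (DE.col-∘-around z≤n (+-monoˡ-≤ (suc l) j≤m) nb-Y)
    go (after ≤p) = ⊥-elim (<⇒≱ (≤-<-trans p≤i+j i+j<i+1+m) ≤p)
    go (around p≤i ≤q′ nb′) = begin
      col X p (q ∸ l)     ≡⟨ CD.col-∘-around p≤i ≤q′ nb′ ⟩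
      col C p (q ∸ l ∸ m) ≡⟨ cong (col C p) (∸|Y|∸1 q) ⟨
      col C p (q ∸ (m + suc l ∸ 1))
        ≡⟨ R.col-∘-around p≤i (subst (_≤ q) shift-i+|Y| (n≤m⇒o≤m∸n⇒n+o≤m l≤q ≤q′)) (not-base-Y nb′) ⟨
      RHS p q             ∎
      where open ≡-Reasoning
    go (crossesˡ p<i i<q″ q′<) = trans (CD.col-∘-crossesˡ p<i i<q″ q′<)
      (sym (R.col-∘-crossesˡ p<i (<-≤-trans i<q″ (m∸n≤m q l))
                             (subst (q <_) shift-i+|Y| (m∸n<o⇒m<n+o {q} {l} q′<))))
    go (crossesʳ i<p p< <q′) = trans (CD.col-∘-crossesʳ i<p p< <q′)
      (sym (R.col-∘-crossesʳ i<p (<-≤-trans p< (+-monoʳ-≤ i 1+m≤|Y|))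
                             (subst (_< q) shift-i+|Y| (o<m∸n⇒n+o<m {q} {l} <q′))))
      where
      1+m≤|Y| : suc m ≤ m + suc l
      1+m≤|Y| = subst (suc m ≤_) (sym (+-suc m l)) (m≤m+n (suc m) l)

  crossesˡ-E : ∀ {p q} → p < q → p < i + j → i + j < q → q < end → LHS p q ≡ RHS p q
  crossesˡ-E {p} {q} p<q p<i+j i+j<q q<end with p <? i
  ... | yes p<i = trans (L.col-∘-crossesˡ p<i+j i+j<q q<end)
          (sym (R.col-∘-crossesˡ p<i (≤-<-trans (m≤m+n i j) i+j<q) (<-≤-trans q<end end≤i+|Y|)))
  ... | no p≮i = trans (L.col-∘-crossesˡ p<i+j i+j<q q<end)
          (sym (trans (R.col-∘-inside p<q i≤p (<⇒≤ (<-≤-trans q<end end≤i+|Y|))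
                         (λ (_ , q≡) → <-irrefl q≡ (<-≤-trans q<end end≤i+|Y|)))
                      (DE.col-∘-crossesˡ (n≤m⇒m<n+o⇒m∸n<o i≤p p<i+j) (m+n<o⇒n<o∸m {i} i+j<q)
                         (n≤m⇒m<n+o⇒m∸n<o (≤-trans i≤p (<⇒≤ p<q))
                            (subst (q <_) (+-assoc i j (suc l)) q<end)))))
    where
    i≤p : i ≤ p
    i≤p = ≮⇒≥ p≮i

  crossesʳ-E : ∀ {p q} → p < q → i + j < p → p < end → end < q → LHS p q ≡ RHS p q
  crossesʳ-E {p} {q} p<q i+j<p p<end end<q with q ≤? i + (m + suc l)
  ... | yes q≤ = trans (L.col-∘-crossesʳ i+j<p p<end end<q)
          (sym (trans (R.col-∘-inside p<q (<⇒≤ i<p) q≤ (λ (p≡i , _) → <-irrefl (sym p≡i) i<p))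
                      (DE.col-∘-crossesʳ (m+n<o⇒n<o∸m {i} i+j<p)
                         (n≤m⇒m<n+o⇒m∸n<o (<⇒≤ i<p) (subst (p <_) (+-assoc i j (suc l)) p<end))
                         (m+n<o⇒n<o∸m {i} (subst (_< q) (+-assoc i j (suc l)) end<q)))))
    where
    i<p : i < p
    i<p = ≤-<-trans (m≤m+n i j) i+j<p
  ... | no q≰ = trans (L.col-∘-crossesʳ i+j<p p<end end<q)
          (sym (R.col-∘-crossesʳ (≤-<-trans (m≤m+n i j) i+j<p) (<-≤-trans p<end end≤i+|Y|) (≰⇒> q≰)))

  glued-E : ¬ (j ≡ 0 × m ≡ 0) → LHS (i + j) end ≡ RHS (i + j) end
  glued-E not-unit = begin
    LHS (i + j) end                                   ≡⟨ L.col-∘-glued refl refl ⟩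
    glue (col X (i + j) (suc (i + j))) (cE 0 (suc l)) ≡⟨ cong (λ x → glue x (cE 0 (suc l))) edge-X ⟩
    glue (cD j (suc j)) (cE 0 (suc l))                ≡⟨ DE.col-∘-glued refl refl ⟨
    col Y j (j + suc l)                               ≡⟨ cong₂ (col Y) (m+n∸m≡n i j) end∸i≡ ⟨
    col Y (i + j ∸ i) (end ∸ i)                       ≡⟨ R.col-∘-inside (m<m+n (i + j) z<s) (m≤m+n i j) end≤i+|Y| nb-C ⟨
    RHS (i + j) end                                   ∎
    where
    open ≡-Reasoning
    j≡0 : i + j ≡ i → j ≡ 0
    j≡0 h = +-cancelˡ-≡ i j 0 (trans h (sym (+-identityʳ i)))
    nb-D : ¬ (i + j ≡ i × suc (i + j) ≡ i + suc m)
    nb-D (h₁ , h₂) = not-unit (j≡0 h₁ , trans (sym (+-cancelˡ-≡ i j m (suc-injective (trans h₂ (+-suc i m)))))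
                                             (j≡0 h₁))
    nb-C : ¬ (i + j ≡ i × end ≡ i + (m + suc l))
    nb-C (h₁ , h₂) = not-unit (j≡0 h₁ ,
      trans (sym (+-cancelʳ-≡ (suc l) j m (+-cancelˡ-≡ i _ _ (trans (sym (+-assoc i j (suc l))) h₂)))) (j≡0 h₁))
    edge-X : col X (i + j) (suc (i + j)) ≡ cD j (suc j)
    edge-X = trans (CD.col-∘-inside (n<1+n (i + j)) (m≤m+n i j) i+j<i+1+m nb-D)
                   (cong₂ cD (m+n∸m≡n i j) (trans (cong (_∸ i) (sym (+-suc i j))) (m+n∸m≡n i (suc j))))
    end∸i≡ : end ∸ i ≡ j + suc l
    end∸i≡ = trans (cong (_∸ i) (+-assoc i j (suc l))) (m+n∸m≡n i (j + suc l))

  agree-off-glued : ∀ {p q} → p < q → ¬ (p ≡ i + j × q ≡ end) → LHS p q ≡ RHS p q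
  agree-off-glued {p} {q} p<q nb with arcPosition (i + j) (suc l) p q
  ... | before q≤ = before-E p<q q≤
  ... | inside ≤p q≤ nb′ = inside-E p<q ≤p q≤ nb′
  ... | glued p≡ q≡ = ⊥-elim (nb (p≡ , q≡))
  ... | after ≤p = after-E p<q ≤p
  ... | around p≤ ≤q nb′ = around-E p<q p≤ ≤q nb′
  ... | crossesˡ p< <q q< = crossesˡ-E p<q p< <q q<
  ... | crossesʳ <p p< <q = crossesʳ-E p<q <p p< <q

glued-E-unit : ∀ C l (cD cE : Colouring) i → GlueAssoc (col C i (suc i)) (cD 0 1) (cE 0 (suc l)) →
               let open SeqAssoc C 0 l cD cE i 0 z≤n in LHS (i + 0) end ≡ RHS (i + 0) end
glued-E-unit C l cD cE i assoc = begin
  col ((C ∘⟨ i ⟩ D) ∘⟨ i + 0 ⟩ E) (i + 0) (i + 0 + suc l)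
      ≡⟨ ∘-Colour.col-∘-glued (C ∘⟨ i ⟩ D) E (i + 0) z<s refl refl ⟩
  glue (col (C ∘⟨ i ⟩ D) (i + 0) (suc (i + 0))) (cE 0 (suc l))
      ≡⟨ cong (λ x → glue x (cE 0 (suc l))) (∘-Colour.col-∘-glued C D i z<s (+-identityʳ i) (sym (+-suc i 0))) ⟩
  glue (glue (col C i (suc i)) (cD 0 1)) (cE 0 (suc l)) ≡⟨ assoc ⟩
  glue (col C i (suc i)) (glue (cD 0 1) (cE 0 (suc l)))
      ≡⟨ cong (glue (col C i (suc i))) (∘-Colour.col-∘-glued D E 0 z<s refl refl) ⟨
  glue (col C i (suc i)) (col (D ∘⟨ 0 ⟩ E) 0 (suc l))
      ≡⟨ ∘-Colour.col-∘-glued C (D ∘⟨ 0 ⟩ E) i z<s (+-identityʳ i) (cong (_+ suc l) (+-identityʳ i)) ⟨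
  col (C ∘⟨ i ⟩ (D ∘⟨ 0 ⟩ E)) (i + 0) (i + 0 + suc l) ∎
  where
  open ≡-Reasoning
  D = mkBNC 1 cD
  E = mkBNC (suc l) cE

seq-glued-arc : ∀ C m l (cD cE : Colouring) i j (j≤m : j ≤ m) →
                (m ≡ 0 → GlueAssoc (col C i (suc i)) (cD 0 1) (cE 0 (suc l))) →
                let open SeqAssoc C m l cD cE i j j≤m in LHS (i + j) end ≡ RHS (i + j) end
seq-glued-arc C zero    l cD cE i zero    z≤n assoc = glued-E-unit C l cD cE i (assoc refl)
seq-glued-arc C (suc m) l cD cE i zero    j≤m _     = SeqAssoc.glued-E C (suc m) l cD cE i zero j≤m (λ ())
seq-glued-arc C m       l cD cE i (suc j) j≤m _     = SeqAssoc.glued-E C m l cD cE i (suc j) j≤m (λ ())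

-- glue is not associative (glue (glue none none) blue ≡ none, glue none (glue none blue) ≡ red); the three
-- colours meet on a single arc exactly when D has size 1.
∘-assoc-seq : ∀ {C D E} i j → j < size D → 0 < size E →
              (size D ≡ 1 → GlueAssoc (col C i (suc i)) (col D 0 1) (col E 0 (size E))) →
              ((C ∘⟨ i ⟩ D) ∘⟨ i + j ⟩ E) ≈ (C ∘⟨ i ⟩ (D ∘⟨ j ⟩ E))
∘-assoc-seq {E = mkBNC zero _} _ _ _ () _
∘-assoc-seq {C} {mkBNC (suc m) cD} {mkBNC (suc l) cE} i j (s≤s j≤m) _ assoc = size≡ , agree
  where
  open SeqAssoc C m l cD cE i j j≤m
  size≡ : size C + suc m ∸ 1 + suc l ∸ 1 ≡ size C + (m + suc l) ∸ 1
  size≡ = begin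
    size C + suc m ∸ 1 + suc l ∸ 1 ≡⟨ m+[1+n]∸1≡m+n _ l ⟩
    size C + suc m ∸ 1 + l         ≡⟨ cong (_+ l) (m+[1+n]∸1≡m+n (size C) m) ⟩
    size C + m + l                 ≡⟨ +-assoc (size C) m l ⟩
    size C + (m + l)               ≡⟨ m+[1+n]∸1≡m+n (size C) (m + l) ⟨
    size C + suc (m + l) ∸ 1       ≡⟨ cong (λ x → size C + x ∸ 1) (+-suc m l) ⟨
    size C + (m + suc l) ∸ 1       ∎
    where open ≡-Reasoning
  agree : Agree (size C + suc m ∸ 1 + suc l ∸ 1) LHS RHS
  agree p q p<q _ with p ≟ i + j | q ≟ end
  ... | yes refl | yes refl = seq-glued-arc C m l cD cE i j j≤m (assoc ∘ cong suc)
  ... | no p≢ | _ = agree-off-glued p<q (λ (p≡ , _) → p≢ p≡)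
  ... | yes _ | no q≢ = agree-off-glued p<q (λ (_ , q≡) → q≢ q≡)

module ParAssoc (C : BNC) (m l : ℕ) (cD cE : Colouring) (i j : ℕ) (i<j : i < j) where
  D = mkBNC (suc m) cD
  E = mkBNC (suc l) cE
  X = C ∘⟨ i ⟩ D
  Z = C ∘⟨ j ⟩ E

  LHS RHS : Colouring
  LHS = col (X ∘⟨ j + m ⟩ E)
  RHS = col (Z ∘⟨ i ⟩ D)

  end : ℕ
  end = j + m + suc l

  private
    module CD = ∘-Colour C D i z<s
    module CE = ∘-Colour C E j z<s
    module L = ∘-Colour X E (j + m) z<s
    module R = ∘-Colour Z D i z<s

    i+1+m≤j+m : i + suc m ≤ j + m
    i+1+m≤j+m = subst (_≤ j + m) (sym (+-suc i m)) (+-monoˡ-≤ m i<j)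

    end≡ : j + m + suc l ≡ suc (l + (j + m))
    end≡ = solve (j ∷ m ∷ l ∷ [])

    m+[j+1+l]≡end : m + (j + suc l) ≡ j + m + suc l
    m+[j+1+l]≡end = solve (j ∷ m ∷ l ∷ [])

    j+m≡m+j : j + m ≡ m + j
    j+m≡m+j = +-comm j m

    i+1+m<end : i + suc m < end
    i+1+m<end = ≤-<-trans i+1+m≤j+m (m<m+n (j + m) z<s)

    ∸[j+m] : ∀ p → p ∸ (j + m) ≡ p ∸ m ∸ j
    ∸[j+m] p = trans (cong (p ∸_) j+m≡m+j) (sym (∸-+-assoc p m j))

    m≤ : ∀ {p} → j + m ≤ p → m ≤ p
    m≤ h = ≤-trans (m≤n+m m j) h

    m≤′ : ∀ {p} → i + suc m ≤ p → m ≤ p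
    m≤′ {p} h = ≤-trans (m≤n+m m (suc i)) (subst (_≤ p) (+-suc i m) h)

    end∸m : ∀ {q} → end ≤ q → j + suc l ≤ q ∸ m
    end∸m {q} h = m+n≤o⇒n≤o∸m {m} (subst (_≤ q) (sym m+[j+1+l]≡end) h)

    nb-E : ∀ {p q} → m ≤ p → m ≤ q → ¬ (p ≡ j + m × q ≡ end) →
           ¬ (p ∸ m ≡ j × q ∸ m ≡ j + suc l)
    nb-E m≤p m≤q nb (p∸m≡j , q∸m≡) = nb (trans (n≤m⇒m∸n≡o⇒m≡n+o m≤p p∸m≡j) (sym j+m≡m+j) ,
                                         trans (n≤m⇒m∸n≡o⇒m≡n+o m≤q q∸m≡) m+[j+1+l]≡end)

  before-E : ∀ {p q} → p < q → q ≤ j + m → LHS p q ≡ RHS p q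
  before-E {p} {q} p<q q≤j+m = trans (L.col-∘-before p<q q≤j+m) (go (arcPosition i (suc m) p q))
    where
    q∸m≤j : q ∸ m ≤ j
    q∸m≤j = m≤n+o⇒m∸n≤o q m (subst (q ≤_) j+m≡m+j q≤j+m)
    go : ArcPosition i (suc m) p q → col X p q ≡ RHS p q
    go (before q≤i) = trans (CD.col-∘-before p<q q≤i)
      (sym (trans (R.col-∘-before p<q q≤i) (CE.col-∘-before p<q (≤-trans q≤i (<⇒≤ i<j)))))
    go (inside i≤p q≤ nb) = trans (CD.col-∘-inside p<q i≤p q≤ nb) (sym (R.col-∘-inside p<q i≤p q≤ nb))
    go (glued p≡i q≡) = trans (CD.col-∘-glued p≡i q≡)
      (sym (trans (R.col-∘-glued p≡i q≡) (cong (λ x → glue x (cD 0 (suc m))) (CE.col-∘-before (n<1+n i) i<j))))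
    go (after ≤p) = trans (CD.col-∘-after p<q ≤p)
      (sym (trans (R.col-∘-after p<q ≤p) (CE.col-∘-before (∸-monoˡ-< p<q (m≤′ ≤p)) q∸m≤j)))
    go (around p≤i ≤q nb) = trans (CD.col-∘-around p≤i ≤q nb)
      (sym (trans (R.col-∘-around p≤i ≤q nb)
                  (CE.col-∘-before (≤-<-trans p≤i i<q∸m) q∸m≤j)))
      where
      i<q∸m : i < q ∸ m
      i<q∸m = m+n<o⇒n<o∸m {m} (subst (_≤ q) (trans (+-suc i m) (cong suc (+-comm i m))) ≤q)
    go (crossesˡ p<i i<q q<) = trans (CD.col-∘-crossesˡ p<i i<q q<) (sym (R.col-∘-crossesˡ p<i i<q q<))
    go (crossesʳ i<p p< <q) = trans (CD.col-∘-crossesʳ i<p p< <q) (sym (R.col-∘-crossesʳ i<p p< <q))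

  inside-E : ∀ {p q} → p < q → j + m ≤ p → q ≤ end → ¬ (p ≡ j + m × q ≡ end) → LHS p q ≡ RHS p q
  inside-E {p} {q} p<q j+m≤p q≤end nb = begin
    LHS p q                         ≡⟨ L.col-∘-inside p<q j+m≤p q≤end nb ⟩
    cE (p ∸ (j + m)) (q ∸ (j + m))  ≡⟨ cong₂ cE (∸[j+m] p) (∸[j+m] q) ⟩
    cE (p ∸ m ∸ j) (q ∸ m ∸ j)      ≡⟨ CE.col-∘-inside (∸-monoˡ-< p<q (m≤ j+m≤p))
                                         (m+n≤o⇒n≤o∸m {m} (subst (_≤ p) j+m≡m+j j+m≤p))
                                         (m≤n+o⇒m∸n≤o q m (subst (q ≤_) (sym m+[j+1+l]≡end) q≤end))
                                         (nb-E (m≤ j+m≤p) (m≤ (≤-trans j+m≤p (<⇒≤ p<q))) nb) ⟨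
    col Z (p ∸ m) (q ∸ m)           ≡⟨ R.col-∘-after p<q (≤-trans i+1+m≤j+m j+m≤p) ⟨
    RHS p q                         ∎
    where open ≡-Reasoning

  glued-E : LHS (j + m) end ≡ RHS (j + m) end
  glued-E = begin
    LHS (j + m) end                                  ≡⟨ L.col-∘-glued refl refl ⟩
    glue (col X (j + m) (suc (j + m))) (cE 0 (suc l)) ≡⟨ cong (λ x → glue x (cE 0 (suc l))) edge-X ⟩
    glue (col C j (suc j)) (cE 0 (suc l))            ≡⟨ CE.col-∘-glued refl refl ⟨
    col Z j (j + suc l)                              ≡⟨ cong₂ (col Z) (m+n∸n≡m j m) end∸m≡ ⟨
    col Z (j + m ∸ m) (end ∸ m)                      ≡⟨ R.col-∘-after (m<m+n (j + m) z<s) i+1+m≤j+m ⟨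
    RHS (j + m) end                                  ∎
    where
    open ≡-Reasoning
    end∸m≡ : end ∸ m ≡ j + suc l
    end∸m≡ = trans (cong (_∸ m) (sym m+[j+1+l]≡end)) (m+n∸m≡n m (j + suc l))
    edge-X : col X (j + m) (suc (j + m)) ≡ col C j (suc j)
    edge-X = trans (CD.col-∘-after (n<1+n (j + m)) i+1+m≤j+m) (cong₂ (col C) (m+n∸n≡m j m) (m+n∸n≡m (suc j) m))

  after-E : ∀ {p q} → p < q → end ≤ p → LHS p q ≡ RHS p q
  after-E {p} {q} p<q end≤p = begin
    LHS p q                       ≡⟨ L.col-∘-after p<q end≤p ⟩
    col X (p ∸ l) (q ∸ l)         ≡⟨ CD.col-∘-after (∸-monoˡ-< p<q l≤p) i+1+m≤p∸l ⟩
    col C (p ∸ l ∸ m) (q ∸ l ∸ m) ≡⟨ cong₂ (col C) (m∸n∸o≡m∸o∸n p l m) (m∸n∸o≡m∸o∸n q l m) ⟩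
    col C (p ∸ m ∸ l) (q ∸ m ∸ l) ≡⟨ CE.col-∘-after (∸-monoˡ-< p<q m≤p) (end∸m end≤p) ⟨
    col Z (p ∸ m) (q ∸ m)         ≡⟨ R.col-∘-after p<q (≤-trans i+1+m≤j+m j+m≤p) ⟨
    RHS p q                       ∎
    where
    open ≡-Reasoning
    l+j+m<p : l + (j + m) < p
    l+j+m<p = subst (_≤ p) end≡ end≤p
    l≤p : l ≤ p
    l≤p = ≤-trans (m≤m+n l (j + m)) (<⇒≤ l+j+m<p)
    j+m≤p : j + m ≤ p
    j+m≤p = ≤-trans (m≤m+n (j + m) (suc l)) end≤p
    m≤p : m ≤ p
    m≤p = m≤ j+m≤p
    i+1+m≤p∸l : i + suc m ≤ p ∸ l
    i+1+m≤p∸l = m+n≤o⇒n≤o∸m {l} (≤-trans (+-monoʳ-≤ l i+1+m≤j+m) (<⇒≤ l+j+m<p))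

  around-E : ∀ {p q} → p < q → p ≤ j + m → end ≤ q → ¬ (p ≡ j + m × q ≡ end) → LHS p q ≡ RHS p q
  around-E {p} {q} p<q p≤j+m end≤q nb =
    trans (L.col-∘-around p≤j+m end≤q nb) (go (arcPosition i (suc m) p (q ∸ l)))
    where
    j+m<q′ : j + m < q ∸ l
    j+m<q′ = m+n<o⇒n<o∸m {l} (subst (_≤ q) end≡ end≤q)
    i+1+m<q′ : i + suc m < q ∸ l
    i+1+m<q′ = ≤-<-trans i+1+m≤j+m j+m<q′
    j+m≤q : j + m ≤ q
    j+m≤q = ≤-trans (m≤m+n (j + m) (suc l)) end≤q
    m≤q : m ≤ q
    m≤q = m≤ j+m≤q
    go : ArcPosition i (suc m) p (q ∸ l) → col X p (q ∸ l) ≡ RHS p q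
    go (before q′≤i) = ⊥-elim (<⇒≱ (≤-<-trans (m≤m+n i (suc m)) i+1+m<q′) q′≤i)
    go (inside _ q′≤ _) = ⊥-elim (<⇒≱ i+1+m<q′ q′≤)
    go (glued _ q′≡) = ⊥-elim (<⇒≱ i+1+m<q′ (≤-reflexive q′≡))
    go (after ≤p) = begin
      col X p (q ∸ l)         ≡⟨ CD.col-∘-after (≤-<-trans p≤j+m j+m<q′) ≤p ⟩
      col C (p ∸ m) (q ∸ l ∸ m) ≡⟨ cong (col C (p ∸ m)) (m∸n∸o≡m∸o∸n q l m) ⟩
      col C (p ∸ m) (q ∸ m ∸ l) ≡⟨ CE.col-∘-around (m≤n+o⇒m∸n≤o p m (subst (p ≤_) j+m≡m+j p≤j+m))
                                     (end∸m end≤q) (nb-E (m≤′ ≤p) m≤q nb) ⟨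
      col Z (p ∸ m) (q ∸ m)     ≡⟨ R.col-∘-after p<q ≤p ⟨
      RHS p q                   ∎
      where open ≡-Reasoning
    go (around p≤i ≤q′ nb′) = begin
      col X p (q ∸ l)     ≡⟨ CD.col-∘-around p≤i ≤q′ nb′ ⟩
      col C p (q ∸ l ∸ m) ≡⟨ cong (col C p) (m∸n∸o≡m∸o∸n q l m) ⟩
      col C p (q ∸ m ∸ l) ≡⟨ CE.col-∘-around (≤-trans p≤i (<⇒≤ i<j)) (end∸m end≤q)
                               (λ (p≡j , _) → <⇒≱ (≤-<-trans p≤i i<j) (≤-reflexive (sym p≡j))) ⟨
      col Z p (q ∸ m)     ≡⟨ R.col-∘-around p≤i (≤-trans i+1+m≤j+m j+m≤q)
                               (λ (_ , q≡) → <⇒≱ (<-≤-trans i+1+m<end end≤q) (≤-reflexive q≡)) ⟨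
      RHS p q             ∎
      where open ≡-Reasoning
    go (crossesˡ _ _ q′<) = ⊥-elim (<⇒≱ i+1+m<q′ (<⇒≤ q′<))
    go (crossesʳ i<p p< <q′) = trans (CD.col-∘-crossesʳ i<p p< <q′)
      (sym (R.col-∘-crossesʳ i<p p< (<-≤-trans i+1+m<end end≤q)))

  crossesˡ-E : ∀ {p q} → p < q → p < j + m → j + m < q → q < end → LHS p q ≡ RHS p q
  crossesˡ-E {p} {q} p<q p<j+m j+m<q q<end = trans (L.col-∘-crossesˡ p<j+m j+m<q q<end) (sym RHS≡none)
    where
    j<q∸m : j < q ∸ m
    j<q∸m = m+n<o⇒n<o∸m {m} (subst (_< q) j+m≡m+j j+m<q)
    q∸m< : q ∸ m < j + suc l
    q∸m< = n≤m⇒m<n+o⇒m∸n<o (m≤ (<⇒≤ j+m<q)) (subst (q <_) (sym m+[j+1+l]≡end) q<end)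
    RHS≡none : RHS p q ≡ none
    RHS≡none with p ≤? i | p <? i + suc m
    ... | yes p≤i | _ = trans (R.col-∘-around p≤i (≤-trans i+1+m≤j+m (<⇒≤ j+m<q))
                                (λ (_ , q≡) → <⇒≱ (≤-<-trans i+1+m≤j+m j+m<q) (≤-reflexive q≡)))
                             (CE.col-∘-crossesˡ (≤-<-trans p≤i i<j) j<q∸m q∸m<)
    ... | no p≰i | yes p< = R.col-∘-crossesʳ (≰⇒> p≰i) p< (≤-<-trans i+1+m≤j+m j+m<q)
    ... | no _   | no p≮ = trans (R.col-∘-after p<q (≮⇒≥ p≮))
                             (CE.col-∘-crossesˡ (n≤m⇒m<n+o⇒m∸n<o (m≤′ (≮⇒≥ p≮)) (subst (p <_) j+m≡m+j p<j+m))
                                                j<q∸m q∸m<)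

  crossesʳ-E : ∀ {p q} → p < q → j + m < p → p < end → end < q → LHS p q ≡ RHS p q
  crossesʳ-E {p} {q} p<q j+m<p p<end end<q = trans (L.col-∘-crossesʳ j+m<p p<end end<q)
    (sym (trans (R.col-∘-after p<q (≤-trans i+1+m≤j+m (<⇒≤ j+m<p)))
                (CE.col-∘-crossesʳ (m+n<o⇒n<o∸m {m} (subst (_< p) j+m≡m+j j+m<p))
                   (n≤m⇒m<n+o⇒m∸n<o (m≤ (<⇒≤ j+m<p)) (subst (p <_) (sym m+[j+1+l]≡end) p<end))
                   (m+n<o⇒n<o∸m {m} (subst (_< q) (sym m+[j+1+l]≡end) end<q)))))

  agree : ∀ {p q} → p < q → LHS p q ≡ RHS p q
  agree {p} {q} p<q with arcPosition (j + m) (suc l) p q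
  ... | before q≤ = before-E p<q q≤
  ... | inside ≤p q≤ nb = inside-E p<q ≤p q≤ nb
  ... | glued refl refl = glued-E
  ... | after ≤p = after-E p<q ≤p
  ... | around p≤ ≤q nb = around-E p<q p≤ ≤q nb
  ... | crossesˡ p< <q q< = crossesˡ-E p<q p< <q q<
  ... | crossesʳ <p p< <q = crossesʳ-E p<q <p p< <q

∘-assoc-par : ∀ {C D E} i j → i < j → (m : ℕ) → size D ≡ suc m → 0 < size E →
              ((C ∘⟨ i ⟩ D) ∘⟨ j + m ⟩ E) ≈ ((C ∘⟨ j ⟩ E) ∘⟨ i ⟩ D)
∘-assoc-par {E = mkBNC zero _} _ _ _ _ _ ()
∘-assoc-par {C} {mkBNC _ cD} {mkBNC (suc l) cE} i j i<j m refl _ =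
  size≡ , λ _ _ p<q _ → ParAssoc.agree C m l cD cE i j i<j p<q
  where
  n = size C
  size≡ : n + suc m ∸ 1 + suc l ∸ 1 ≡ n + suc l ∸ 1 + suc m ∸ 1
  size≡ = begin
    n + suc m ∸ 1 + suc l ∸ 1 ≡⟨ m+[1+n]∸1≡m+n _ l ⟩
    n + suc m ∸ 1 + l         ≡⟨ cong (_+ l) (m+[1+n]∸1≡m+n n m) ⟩
    n + m + l                 ≡⟨ xy∙z≈xz∙y n m l ⟩
    n + l + m                 ≡⟨ cong (_+ m) (m+[1+n]∸1≡m+n n l) ⟨
    n + suc l ∸ 1 + m         ≡⟨ m+[1+n]∸1≡m+n _ m ⟨
    n + suc l ∸ 1 + suc m ∸ 1 ∎
    where open ≡-Reasoning

glue-blueˡ : ∀ x → x ≢ red → glue blue x ≡ x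
glue-blueˡ blue _ = refl
glue-blueˡ red x≢red = ⊥-elim (x≢red refl)
glue-blueˡ none _ = refl

∘-identityˡ : ∀ D → 0 < size D → col D 0 (size D) ≢ red → (unitB ∘⟨ 0 ⟩ D) ≈ D
∘-identityˡ D 0<m base≢red = refl , agree
  where
  open ∘-Colour unitB D 0 0<m
  agree : Agree (size D) (col (unitB ∘⟨ 0 ⟩ D)) (col D)
  agree p q p<q q≤m with arcPosition 0 (size D) p q
  ... | before q≤0 = ⊥-elim (<⇒≱ (≤-<-trans z≤n p<q) q≤0)
  ... | inside _ q≤ nb = col-∘-inside p<q z≤n q≤ nb
  ... | glued refl refl = trans (col-∘-glued refl refl) (glue-blueˡ _ base≢red)
  ... | after m≤p = ⊥-elim (<⇒≱ (<-≤-trans p<q q≤m) m≤p)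
  ... | around p≤0 m≤q nb = ⊥-elim (nb (n≤0⇒n≡0 p≤0 , ≤-antisym q≤m m≤q))
  ... | crossesˡ () _ _
  ... | crossesʳ _ _ m<q = ⊥-elim (<⇒≱ m<q q≤m)

0<arity : ∀ t → 0 < arity t
0<arity leaf = z<s
0<arity (node _ l _) = ≤-trans (0<arity l) (m≤m+n _ _)

2≤arity-node : ∀ g l r → 2 ≤ arity (node g l r)
2≤arity-node _ l r = ≤-trans (s≤s (0<arity l)) (m<m+n (arity l) (0<arity r))

arity≡1⇒leaf : ∀ t → arity t ≡ 1 → t ≡ leaf
arity≡1⇒leaf leaf _ = refl
arity≡1⇒leaf (node g l r) e = ⊥-elim (<-irrefl (sym e) (2≤arity-node g l r))

suc-pred-arity : ∀ t → arity t ≡ suc (arity t ∸ 1)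
suc-pred-arity t = sym (m+[n∸m]≡n {1} (0<arity t))

graft-left : ∀ g l r k t → k < arity l → graft (node g l r) k t ≡ node g (graft l k t) r
graft-left g l r k t k<a rewrite ≤ᵇ-true k<a = refl

graft-right : ∀ g l r k t → arity l ≤ k → graft (node g l r) k t ≡ node g l (graft r (k ∸ arity l) t)
graft-right g l r k t a≤k rewrite ≤ᵇ-false {suc k} {arity l} (s≤s a≤k) = refl

arity-graft : ∀ s k t → k < arity s → arity (graft s k t) ≡ arity s + (arity t ∸ 1)
arity-graft leaf zero t _ = suc-pred-arity t
arity-graft leaf (suc _) t (s≤s ())
arity-graft (node g l r) k t k< with k <? arity l
... | yes k<a rewrite graft-left g l r k t k<a | arity-graft l k t k<a = xy∙z≈xz∙y (arity l) _ (arity r)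
... | no k≮a rewrite graft-right g l r k t (≮⇒≥ k≮a)
                   | arity-graft r (k ∸ arity l) t (n≤m⇒m<n+o⇒m∸n<o (≮⇒≥ k≮a) k<) = sym (+-assoc (arity l) (arity r) _)

size-π : ∀ t → size (π t) ≡ arity t
size-π leaf = refl
size-π (node α l r) = cong₂ _+_ (size-π l) (size-π r)
size-π (node β l r) = cong₂ _+_ (size-π l) (size-π r)

0<size-π : ∀ t → 0 < size (π t)
0<size-π t = subst (0 <_) (sym (size-π t)) (0<arity t)

size-πg : ∀ g → size (πg g) ≡ 2
size-πg α = refl
size-πg β = refl

0<size-πg : ∀ g → 0 < size (πg g)
0<size-πg g = subst (0 <_) (sym (size-πg g)) z<s

size-πg∘ : ∀ g X → size (πg g ∘⟨ 0 ⟩ X) ≡ suc (size X)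
size-πg∘ α X = refl
size-πg∘ β X = refl

arity-l<size-πg∘ : ∀ g l → arity l < size (πg g ∘⟨ 0 ⟩ π l)
arity-l<size-πg∘ g l = subst (arity l <_) (sym (trans (size-πg∘ g (π l)) (cong suc (size-π l)))) (n<1+n _)

-- The base and the second edge of π (gt g) have the same colour.
genColour : Gen → Colour
genColour α = blue
genColour β = none

genColour≢red : ∀ g → genColour g ≢ red
genColour≢red α ()
genColour≢red β ()

col-πg-edge₁ : ∀ g → col (πg g) 0 1 ≡ blue
col-πg-edge₁ α = refl
col-πg-edge₁ β = refl

col-πg-base : ∀ g → col (πg g) 0 2 ≡ genColour g
col-πg-base α = refl
col-πg-base β = refl

col-πg-edge₂ : ∀ g → col (πg g) 1 2 ≡ genColour g
col-πg-edge₂ α = refl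
col-πg-edge₂ β = refl

module NodeColour (g : Gen) (l r : Tree) where
  a n : ℕ
  a = arity l
  n = arity l + arity r

  X₀ : BNC
  X₀ = πg g ∘⟨ 0 ⟩ π l

  ct : Colouring
  ct = col (π (node g l r))

  0<a : 0 < a
  0<a = 0<arity l

  a<n : a < n
  a<n = m<m+n a (0<arity r)

  private
    module Outer = ∘-Colour X₀ (π r) a (0<size-π r)
    module Inner = ∘-Colour (πg g) (π l) 0 (0<size-π l)

    n≡a+|r| : n ≡ a + size (π r)
    n≡a+|r| = cong (a +_) (sym (size-π r))

    shift-by-a : ∀ k → k ∸ (size (π l) ∸ 1) ≡ k ∸ (a ∸ 1)
    shift-by-a k = cong (λ x → k ∸ (x ∸ 1)) (size-π l)

    n∸[|r|∸1]≡1+a : n ∸ (size (π r) ∸ 1) ≡ suc a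
    n∸[|r|∸1]≡1+a = begin
      n ∸ (size (π r) ∸ 1)                 ≡⟨ cong (λ x → n ∸ (x ∸ 1)) (size-π r) ⟩
      a + arity r ∸ (arity r ∸ 1)          ≡⟨ cong (λ x → a + x ∸ (arity r ∸ 1)) (suc-pred-arity r) ⟩
      a + suc (arity r ∸ 1) ∸ (arity r ∸ 1) ≡⟨ cong (_∸ (arity r ∸ 1)) (+-suc a (arity r ∸ 1)) ⟩
      suc a + (arity r ∸ 1) ∸ (arity r ∸ 1) ≡⟨ m+n∸n≡m (suc a) (arity r ∸ 1) ⟩
      suc a                                ∎
      where open ≡-Reasoning

    k+a∸[a∸1]≡k+1 : ∀ k → k + a ∸ (a ∸ 1) ≡ suc k
    k+a∸[a∸1]≡k+1 k = begin
      k + a ∸ (a ∸ 1)             ≡⟨ cong (λ x → k + x ∸ (a ∸ 1)) (suc-pred-arity l) ⟩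
      k + suc (a ∸ 1) ∸ (a ∸ 1)   ≡⟨ cong (_∸ (a ∸ 1)) (+-suc k (a ∸ 1)) ⟩
      suc k + (a ∸ 1) ∸ (a ∸ 1)   ≡⟨ m+n∸n≡m (suc k) (a ∸ 1) ⟩
      suc k                       ∎
      where open ≡-Reasoning

  col-left : ∀ {p q} → p < q → q ≤ a → ¬ (p ≡ 0 × q ≡ a) → ct p q ≡ col (π l) p q
  col-left {p} {q} p<q q≤a nb = trans (Outer.col-∘-before p<q q≤a)
    (Inner.col-∘-inside p<q z≤n (subst (q ≤_) (sym (size-π l)) q≤a)
                        (λ (p≡0 , q≡) → nb (p≡0 , trans q≡ (size-π l))))

  col-left-base : ct 0 a ≡ glue blue (col (π l) 0 a)
  col-left-base = trans (Outer.col-∘-before 0<a ≤-refl)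
    (trans (Inner.col-∘-glued refl (sym (size-π l))) (cong₂ glue (col-πg-edge₁ g) (cong (col (π l) 0) (size-π l))))

  col-right : ∀ {p q} → p < q → a ≤ p → q ≤ n → ¬ (p ≡ a × q ≡ n) →
              ct p q ≡ col (π r) (p ∸ a) (q ∸ a)
  col-right {p} {q} p<q a≤p q≤n nb =
    Outer.col-∘-inside p<q a≤p (subst (q ≤_) n≡a+|r| q≤n)
                       (λ (p≡a , q≡) → nb (p≡a , trans q≡ (sym n≡a+|r|)))

  col-right-shifted : ∀ {p q} → p < q → q ≤ arity r → ¬ (p ≡ 0 × q ≡ arity r) →
                      ct (a + p) (a + q) ≡ col (π r) p q
  col-right-shifted {p} {q} p<q q≤ nb =
    trans (col-right (+-monoʳ-< a p<q) (m≤m+n a p) (+-monoʳ-≤ a q≤) nb′)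
          (cong₂ (col (π r)) (m+n∸m≡n a p) (m+n∸m≡n a q))
    where
    nb′ : ¬ (a + p ≡ a × a + q ≡ n)
    nb′ (e₁ , e₂) = nb (+-cancelˡ-≡ a p 0 (trans e₁ (sym (+-identityʳ a))) , +-cancelˡ-≡ a q (arity r) e₂)

  col-X₀-edge₂ : col X₀ a (suc a) ≡ genColour g
  col-X₀-edge₂ = begin
    col X₀ a (suc a)                           ≡⟨ Inner.col-∘-after (n<1+n a) (≤-reflexive (size-π l)) ⟩
    col (πg g) (a ∸ (size (π l) ∸ 1)) (suc a ∸ (size (π l) ∸ 1))
                                               ≡⟨ cong₂ (col (πg g)) (shift-by-a a) (shift-by-a (suc a)) ⟩
    col (πg g) (a ∸ (a ∸ 1)) (suc a ∸ (a ∸ 1)) ≡⟨ cong₂ (col (πg g)) (k+a∸[a∸1]≡k+1 0) (k+a∸[a∸1]≡k+1 1) ⟩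
    col (πg g) 1 2                             ≡⟨ col-πg-edge₂ g ⟩
    genColour g                                ∎
    where open ≡-Reasoning

  col-right-base : ct a n ≡ glue (genColour g) (col (π r) 0 (arity r))
  col-right-base =
    trans (Outer.col-∘-glued refl n≡a+|r|) (cong₂ glue col-X₀-edge₂ (cong (col (π r) 0) (size-π r)))

  col-base : ct 0 n ≡ genColour g
  col-base = begin
    ct 0 n                                  ≡⟨ Outer.col-∘-around z≤n (≤-reflexive (sym n≡a+|r|))
                                                                  (λ (0≡a , _) → <-irrefl 0≡a 0<a) ⟩
    col X₀ 0 (n ∸ (size (π r) ∸ 1))         ≡⟨ cong (col X₀ 0) n∸[|r|∸1]≡1+a ⟩
    col X₀ 0 (suc a)                        ≡⟨ Inner.col-∘-around z≤n (subst (_≤ suc a) (sym (size-π l)) (n≤1+n a))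
                                                 (λ (_ , 1+a≡) → <-irrefl (sym (trans 1+a≡ (size-π l))) (n<1+n a)) ⟩
    col (πg g) 0 (suc a ∸ (size (π l) ∸ 1)) ≡⟨ cong (col (πg g) 0) (trans (shift-by-a (suc a)) (k+a∸[a∸1]≡k+1 1)) ⟩
    col (πg g) 0 2                          ≡⟨ col-πg-base g ⟩
    genColour g                             ∎
    where open ≡-Reasoning

  col-crossing : ∀ {p q} → p < a → a < q → q ≤ n → ¬ (p ≡ 0 × q ≡ n) → ct p q ≡ none
  col-crossing {p} {q} p<a a<q q≤n nb with m≤n⇒m<n∨m≡n q≤n
  ... | inj₁ q<n = Outer.col-∘-crossesˡ p<a a<q (subst (q <_) n≡a+|r| q<n)
  ... | inj₂ refl = begin
    ct p n                          ≡⟨ Outer.col-∘-around (<⇒≤ p<a) (≤-reflexive (sym n≡a+|r|))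
                                                          (λ (p≡a , _) → <-irrefl p≡a p<a) ⟩
    col X₀ p (n ∸ (size (π r) ∸ 1)) ≡⟨ cong (col X₀ p) n∸[|r|∸1]≡1+a ⟩
    col X₀ p (suc a)                ≡⟨ Inner.col-∘-crossesʳ 0<p (subst (p <_) (sym (size-π l)) p<a)
                                         (subst (_< suc a) (sym (size-π l)) (n<1+n a)) ⟩
    none                            ∎
    where
    open ≡-Reasoning
    0<p : 0 < p
    0<p = ≤∧≢⇒< z≤n (λ 0≡p → nb (sym 0≡p , refl))

baseColour : Tree → Colour
baseColour leaf = blue
baseColour (node g _ _) = genColour g

baseColour≢red : ∀ t → baseColour t ≢ red
baseColour≢red leaf ()
baseColour≢red (node g _ _) = genColour≢red g

col-π-base : ∀ t → col (π t) 0 (arity t) ≡ baseColour t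
col-π-base leaf = refl
col-π-base (node g l r) = NodeColour.col-base g l r

col-π-base≢red : ∀ t → col (π t) 0 (arity t) ≢ red
col-π-base≢red t e = baseColour≢red t (trans (sym (col-π-base t)) e)

RedDiagonals : ℕ → Colouring → Set
RedDiagonals n c = ∀ p q → p < q → q ≤ n → c p q ≡ red → (q ≢ suc p) × ¬ (p ≡ 0 × q ≡ n)

NonCrossing : ℕ → Colouring → Set
NonCrossing n c = ∀ p q p′ q′ → p < p′ → p′ < q → q < q′ → q′ ≤ n →
                  c p q ≢ none → c p′ q′ ≢ none → ⊥

data NodeArcPosition (a n p q : ℕ) : Set where
  in-left    : q ≤ a → ¬ (p ≡ 0 × q ≡ a) → NodeArcPosition a n p q
  left-base  : p ≡ 0 → q ≡ a → NodeArcPosition a n p q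
  in-right   : a ≤ p → ¬ (p ≡ a × q ≡ n) → NodeArcPosition a n p q
  right-base : p ≡ a → q ≡ n → NodeArcPosition a n p q
  root-base  : p ≡ 0 → q ≡ n → NodeArcPosition a n p q
  crossing   : p < a → a < q → ¬ (p ≡ 0 × q ≡ n) → NodeArcPosition a n p q

nodeArcPosition : ∀ a n p q → NodeArcPosition a n p q
nodeArcPosition a n p q with q ≤? a | a ≤? p | p ≟ 0 | q ≟ a | p ≟ a | q ≟ n
... | yes q≤a | _ | yes p≡0 | yes q≡a | _ | _ = left-base p≡0 q≡a
... | yes q≤a | _ | no p≢0  | _ | _ | _ = in-left q≤a (λ (p≡0 , _) → p≢0 p≡0)
... | yes q≤a | _ | yes _   | no q≢a | _ | _ = in-left q≤a (λ (_ , q≡a) → q≢a q≡a)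
... | no _ | yes a≤p | _ | _ | yes p≡a | yes q≡n = right-base p≡a q≡n
... | no _ | yes a≤p | _ | _ | no p≢a  | _ = in-right a≤p (λ (p≡a , _) → p≢a p≡a)
... | no _ | yes a≤p | _ | _ | yes _   | no q≢n = in-right a≤p (λ (_ , q≡n) → q≢n q≡n)
... | no _ | no _ | yes p≡0 | _ | _ | yes q≡n = root-base p≡0 q≡n
... | no q≰a | no a≰p | no p≢0 | _ | _ | _ =
  crossing (≰⇒> a≰p) (≰⇒> q≰a) (λ (p≡0 , _) → p≢0 p≡0)
... | no q≰a | no a≰p | yes _ | _ | _ | no q≢n =
  crossing (≰⇒> a≰p) (≰⇒> q≰a) (λ (_ , q≡n) → q≢n q≡n)

glue-blueˡ≢red : ∀ x → glue blue x ≢ red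
glue-blueˡ≢red blue ()
glue-blueˡ≢red red ()
glue-blueˡ≢red none ()

glue≡red⇒none : ∀ x y → glue x y ≡ red → y ≡ none
glue≡red⇒none none none _ = refl
glue≡red⇒none none blue ()
glue≡red⇒none none red ()
glue≡red⇒none blue blue ()
glue≡red⇒none blue red ()
glue≡red⇒none blue none ()
glue≡red⇒none red _ ()

baseColour≡none⇒2≤arity : ∀ t → baseColour t ≡ none → 2 ≤ arity t
baseColour≡none⇒2≤arity (node g l r) _ = 2≤arity-node g l r

redDiagonals-π : ∀ t → RedDiagonals (arity t) (col (π t))
redDiagonals-π leaf 0 1 _ _ ()
redDiagonals-π leaf 0 (suc (suc _)) _ (s≤s ())
redDiagonals-π leaf (suc _) 1 (s≤s ()) _
redDiagonals-π leaf (suc _) (suc (suc _)) _ (s≤s ())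
redDiagonals-π (node g l r) p q p<q q≤n red≡ = cases (nodeArcPosition a n p q)
  where
  open NodeColour g l r
  cases : NodeArcPosition a n p q → (q ≢ suc p) × ¬ (p ≡ 0 × q ≡ n)
  cases (in-left q≤a nb) =
    proj₁ (redDiagonals-π l p q p<q q≤a (trans (sym (col-left p<q q≤a nb)) red≡)) ,
    λ (_ , q≡n) → <-irrefl q≡n (≤-<-trans q≤a a<n)
  cases (left-base refl refl) = ⊥-elim (glue-blueˡ≢red _ (trans (sym col-left-base) red≡))
  cases (in-right a≤p nb) =
    (λ q≡1+p → not-edge (trans (cong (_∸ a) q≡1+p) (+-∸-assoc 1 a≤p))) ,
    λ (p≡0 , _) → <-irrefl (sym p≡0) (<-≤-trans 0<a a≤p)
    where
    not-edge = proj₁ (redDiagonals-π r (p ∸ a) (q ∸ a) (∸-monoˡ-< p<q a≤p) (m≤n+o⇒m∸n≤o q a q≤n)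
                                       (trans (sym (col-right p<q a≤p q≤n nb)) red≡))
  cases (right-base refl refl) =
    (λ n≡1+a → <⇒≱ (s≤s (≤-reflexive (+-cancelˡ-≡ a _ _ (trans n≡1+a (+-comm 1 a))))) 2≤|r|) ,
    λ (a≡0 , _) → <-irrefl (sym a≡0) 0<a
    where
    2≤|r| : 2 ≤ arity r
    2≤|r| = baseColour≡none⇒2≤arity r
              (trans (sym (col-π-base r)) (glue≡red⇒none (genColour g) _ (trans (sym col-right-base) red≡)))
  cases (root-base refl refl) = ⊥-elim (genColour≢red g (trans (sym col-base) red≡))
  cases (crossing p<a a<q nb) with trans (sym (col-crossing p<a a<q q≤n nb)) red≡
  ... | ()

noCrossing-π : ∀ t → NonCrossing (arity t) (col (π t))
noCrossing-π leaf p q p′ q′ p<p′ p′<q q<q′ q′≤1 _ _ = <⇒≱ (<-trans (≤-<-trans (≤-<-trans z≤n p<p′) p′<q) q<q′) q′≤1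
noCrossing-π (node g l r) p q p′ q′ p<p′ p′<q q<q′ q′≤n c≢none c′≢none = cases (q′ ≤? a) (q ≤? a) (p <? a)
  where
  open NodeColour g l r
  p<q : p < q
  p<q = <-trans p<p′ p′<q
  p′<q′ : p′ < q′
  p′<q′ = <-trans p′<q q<q′
  q≤n : q ≤ n
  q≤n = ≤-trans (<⇒≤ q<q′) q′≤n
  not-from-0 : ∀ {x y} → ¬ (p′ ≡ 0 × x ≡ y)
  not-from-0 (p′≡0 , _) = <-irrefl (sym p′≡0) (≤-<-trans z≤n p<p′)
  not-to-end : ∀ {x y} → ¬ (x ≡ y × q ≡ n)
  not-to-end (_ , q≡n) = <⇒≱ q<q′ (≤-trans q′≤n (≤-reflexive (sym q≡n)))
  cases : Dec (q′ ≤ a) → Dec (q ≤ a) → Dec (p < a) → ⊥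
  cases (yes q′≤a) _ _ =
    noCrossing-π l p q p′ q′ p<p′ p′<q q<q′ q′≤a
      (c≢none ∘ trans (col-left p<q q≤a (λ (_ , q≡a) → <⇒≱ (<-≤-trans q<q′ q′≤a) (≤-reflexive (sym q≡a)))))
      (c′≢none ∘ trans (col-left p′<q′ q′≤a not-from-0))
    where
    q≤a : q ≤ a
    q≤a = <⇒≤ (<-≤-trans q<q′ q′≤a)
  cases (no q′≰a) (yes q≤a) _ = c′≢none (col-crossing (<-≤-trans p′<q q≤a) (≰⇒> q′≰a) q′≤n not-from-0)
  cases (no _) (no q≰a) (yes p<a) = c≢none (col-crossing p<a (≰⇒> q≰a) q≤n not-to-end)
  cases (no _) (no _) (no p≮a) =
    noCrossing-π r (p ∸ a) (q ∸ a) (p′ ∸ a) (q′ ∸ a) (∸-monoˡ-< p<p′ a≤p) (∸-monoˡ-< p′<q a≤p′)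
      (∸-monoˡ-< q<q′ (≤-trans a≤p′ (<⇒≤ p′<q))) (m≤n+o⇒m∸n≤o q′ a q′≤n)
      (c≢none ∘ trans (col-right p<q a≤p q≤n not-to-end))
      (c′≢none ∘ trans (col-right p′<q′ a≤p′ q′≤n (λ (p′≡a , _) → <-irrefl (sym p′≡a) (≤-<-trans a≤p p<p′))))
    where
    a≤p : a ≤ p
    a≤p = ≮⇒≥ p≮a
    a≤p′ : a ≤ p′
    a≤p′ = ≤-trans a≤p (<⇒≤ p<p′)

isBNC-π : ∀ t → IsBNC (π t)
isBNC-π t rewrite size-π t =
  0<arity t ,
  (λ arity≡1 → subst (λ u → col (π u) 0 1 ≡ blue) (sym (arity≡1⇒leaf t arity≡1)) refl) ,
  λ _ → redDiagonals-π t , noCrossing-π t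

≈-setoid : Setoid 0ℓ 0ℓ
≈-setoid = record
  { Carrier = BNC ; _≈_ = _≈_ ; isEquivalence = record { refl = ≈-refl ; sym = ≈-sym ; trans = ≈-trans } }

glue-assoc-blue : ∀ x z → x ≢ red → z ≢ red → GlueAssoc x blue z
glue-assoc-blue blue blue _ _ = refl
glue-assoc-blue blue none _ _ = refl
glue-assoc-blue none blue _ _ = refl
glue-assoc-blue none none _ _ = refl
glue-assoc-blue red _ x≢red _ = ⊥-elim (x≢red refl)
glue-assoc-blue _ red _ z≢red = ⊥-elim (z≢red refl)

col-π-base≢red′ : ∀ t → col (π t) 0 (size (π t)) ≢ red
col-π-base≢red′ t = subst (λ n → col (π t) 0 n ≢ red) (sym (size-π t)) (col-π-base≢red t)

col-π-unit : ∀ t → size (π t) ≡ 1 → col (π t) 0 1 ≡ blue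
col-π-unit t size≡1 rewrite arity≡1⇒leaf t (trans (sym (size-π t)) size≡1) = refl

π-graft : ∀ s k t → k < arity s → π (graft s k t) ≈ (π s ∘⟨ k ⟩ π t)
π-graft leaf zero t _ = ≈-sym (∘-identityˡ (π t) (0<size-π t) (col-π-base≢red′ t))
π-graft leaf (suc _) t (s≤s ())
π-graft (node g l r) k t k< with k <? arity l
... | yes k<a rewrite graft-left g l r k t k<a = begin
  π (node g l′ r)
    ≈⟨ ∘-congʳ (π r) (arity l′) (∘-congˡ (πg g) 0 (π-graft l k t k<a) (0<size-πg g) (0<size-π l′))
               (arity-l<size-πg∘ g l′) (0<size-π r) ⟩
  ((πg g ∘⟨ 0 ⟩ (π l ∘⟨ k ⟩ π t)) ∘⟨ arity l′ ⟩ π r)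
    ≈⟨ ≈-reflexive (cong (λ i → (πg g ∘⟨ 0 ⟩ (π l ∘⟨ k ⟩ π t)) ∘⟨ i ⟩ π r) (arity-graft l k t k<a)) ⟩
  ((πg g ∘⟨ 0 ⟩ (π l ∘⟨ k ⟩ π t)) ∘⟨ a + m ⟩ π r)
    ≈⟨ ∘-congʳ (π r) (a + m) inner-assoc (≤-reflexive (sym size≡)) (0<size-π r) ⟨
  ((X₀ ∘⟨ k ⟩ π t) ∘⟨ a + m ⟩ π r)
    ≈⟨ ∘-assoc-par {X₀} {π t} {π r} k a k<a m (size-π-pred t) (0<size-π r) ⟩
  ((X₀ ∘⟨ a ⟩ π r) ∘⟨ k ⟩ π t)
    ∎
  where
  open Relation.Binary.Reasoning.Setoid ≈-setoid
  open NodeColour g l r using (a; X₀)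
  l′ = graft l k t
  m = arity t ∸ 1
  size-π-pred : ∀ u → size (π u) ≡ suc (arity u ∸ 1)
  size-π-pred u = trans (size-π u) (suc-pred-arity u)
  inner-assoc : (X₀ ∘⟨ k ⟩ π t) ≈ (πg g ∘⟨ 0 ⟩ (π l ∘⟨ k ⟩ π t))
  inner-assoc = ∘-assoc-seq {πg g} {π l} {π t} 0 k (subst (k <_) (sym (size-π l)) k<a) (0<size-π t)
                  (λ size≡1 → subst (λ x → GlueAssoc x (col (π l) 0 1) _) (sym (col-πg-edge₁ g))
                                (subst (λ y → GlueAssoc blue y _) (sym (col-π-unit l size≡1))
                                  (glue-assoc-blue blue _ (λ ()) (col-π-base≢red′ t))))
  size≡ : size (X₀ ∘⟨ k ⟩ π t) ≡ suc (a + m)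
  size≡ = trans (cong₂ (λ x y → x + y ∸ 1) (trans (size-πg∘ g (π l)) (cong suc (size-π l))) (size-π-pred t))
                (m+[1+n]∸1≡m+n (suc a) m)
... | no k≮a rewrite graft-right g l r k t (≮⇒≥ k≮a) = begin
  π (node g l r′)
    ≈⟨ ∘-congˡ X₀ a (π-graft r (k ∸ a) t k∸a<) (arity-l<size-πg∘ g l) (0<size-π r′) ⟩
  (X₀ ∘⟨ a ⟩ (π r ∘⟨ k ∸ a ⟩ π t))
    ≈⟨ outer-assoc ⟨
  ((X₀ ∘⟨ a ⟩ π r) ∘⟨ a + (k ∸ a) ⟩ π t)
    ≈⟨ ≈-reflexive (cong (λ i → (X₀ ∘⟨ a ⟩ π r) ∘⟨ i ⟩ π t) (m+[n∸m]≡n (≮⇒≥ k≮a))) ⟩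
  ((X₀ ∘⟨ a ⟩ π r) ∘⟨ k ⟩ π t)
    ∎
  where
  open Relation.Binary.Reasoning.Setoid ≈-setoid
  open NodeColour g l r using (a; X₀; col-X₀-edge₂)
  k∸a< : k ∸ a < arity r
  k∸a< = n≤m⇒m<n+o⇒m∸n<o (≮⇒≥ k≮a) k<
  r′ = graft r (k ∸ a) t
  outer-assoc : ((X₀ ∘⟨ a ⟩ π r) ∘⟨ a + (k ∸ a) ⟩ π t) ≈ (X₀ ∘⟨ a ⟩ (π r ∘⟨ k ∸ a ⟩ π t))
  outer-assoc = ∘-assoc-seq {X₀} {π r} {π t} a (k ∸ a) (subst (k ∸ a <_) (sym (size-π r)) k∸a<) (0<size-π t)
                  (λ size≡1 → subst (λ x → GlueAssoc x (col (π r) 0 1) _) (sym col-X₀-edge₂)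
                                (subst (λ y → GlueAssoc (genColour g) y _) (sym (col-π-unit r size≡1))
                                  (glue-assoc-blue (genColour g) _ (genColour≢red g) (col-π-base≢red′ t))))

_≟ᶜ_ : (x y : Colour) → Dec (x ≡ y)
blue ≟ᶜ blue = yes refl
red  ≟ᶜ red  = yes refl
none ≟ᶜ none = yes refl
blue ≟ᶜ red  = no λ ()
blue ≟ᶜ none = no λ ()
red  ≟ᶜ blue = no λ ()
red  ≟ᶜ none = no λ ()
none ≟ᶜ blue = no λ ()
none ≟ᶜ red  = no λ ()

agree? : ∀ n (c c′ : Colouring) → Dec (∀ {q} → q < suc n → ∀ {p} → p < q → c p q ≡ c′ p q)
agree? n c c′ = allUpTo? (λ q → allUpTo? (λ p → c p q ≟ᶜ c′ p q) q) (suc n)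

agree-by-computation : ∀ n (c c′ : Colouring) → {True (agree? n c c′)} → Agree n c c′
agree-by-computation n c c′ {yes!} p q p<q q≤n = toWitness yes! (s≤s q≤n) p<q

π-gt : ∀ g → π (gt g) ≈ πg g
π-gt α = refl , agree-by-computation 2 _ _
π-gt β = refl , agree-by-computation 2 _ _

π-resp-≡F : ∀ {s t} → s ≡F t → π s ≈ π t
π-resp-≡F cg-refl = ≈-refl
π-resp-≡F (cg-sym t≡s) = ≈-sym (π-resp-≡F t≡s)
π-resp-≡F (cg-trans s≡u u≡t) = ≈-trans (π-resp-≡F s≡u) (π-resp-≡F u≡t)
π-resp-≡F (cg-comp {s} {s′} {t} {t′} k k< s≡s′ t≡t′) = begin
  π (graft s k t)    ≈⟨ π-graft s k t k< ⟩
  (π s ∘⟨ k ⟩ π t)   ≈⟨ ∘-cong k πs≈πs′ (π-resp-≡F t≡t′) (subst (k <_) (sym (size-π s)) k<) (0<size-π t) ⟩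
  (π s′ ∘⟨ k ⟩ π t′) ≈⟨ π-graft s′ k t′ k<′ ⟨
  π (graft s′ k t′)  ∎
  where
  open Relation.Binary.Reasoning.Setoid ≈-setoid
  πs≈πs′ = π-resp-≡F s≡s′
  k<′ : k < arity s′
  k<′ = subst (k <_) (trans (sym (size-π s)) (trans (proj₁ πs≈πs′) (size-π s′))) k<
π-resp-≡F cg-rel₁ = refl , agree-by-computation 4 _ _
π-resp-≡F cg-rel₂ = refl , agree-by-computation 4 _ _

inGen-πg : ∀ g → InGen (πg g)
inGen-πg α = gen-aaa
inGen-πg β = gen-abb

inGen-π : ∀ t → InGen (π t)
inGen-π leaf = gen-unit
inGen-π (node g l r) =
  gen-comp (arity l) (arity-l<size-πg∘ g l) (gen-comp 0 (0<size-πg g) (inGen-πg g) (inGen-π l)) (inGen-π r)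

inGen⇒image : ∀ C → InGen C → Σ Tree (λ t → π t ≈ C)
inGen⇒image _ gen-unit = leaf , ≈-refl
inGen⇒image _ gen-aaa = gt α , π-gt α
inGen⇒image _ gen-abb = gt β , π-gt β
inGen⇒image _ (gen-comp {C} {D} k k< C∈ D∈) with inGen⇒image C C∈ | inGen⇒image D D∈
... | s , πs≈C | t , πt≈D = graft s k t , (begin
  π (graft s k t)  ≈⟨ π-graft s k t k<′ ⟩
  (π s ∘⟨ k ⟩ π t) ≈⟨ ∘-cong k πs≈C πt≈D (subst (k <_) (sym (size-π s)) k<′) (0<size-π t) ⟩
  (C ∘⟨ k ⟩ D)     ∎)
  where
  open Relation.Binary.Reasoning.Setoid ≈-setoid
  k<′ : k < arity s
  k<′ = subst (k <_) (trans (sym (proj₁ πs≈C)) (size-π s)) k<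

redDiagonals-agree : ∀ {n c c′} → Agree n c c′ → RedDiagonals n c → RedDiagonals n c′
redDiagonals-agree f h p q p<q q≤n red≡ = h p q p<q q≤n (trans (f p q p<q q≤n) red≡)

noCrossing-agree : ∀ {n c c′} → Agree n c c′ → NonCrossing n c → NonCrossing n c′
noCrossing-agree f h p q p′ q′ p<p′ p′<q q<q′ q′≤n c≢none c′≢none =
  h p q p′ q′ p<p′ p′<q q<q′ q′≤n
    (c≢none ∘ trans (sym (f p q (<-trans p<p′ p′<q) (≤-trans (<⇒≤ q<q′) q′≤n))))
    (c′≢none ∘ trans (sym (f p′ q′ (<-trans p′<q q<q′) q′≤n)))

isBNC-≈ : ∀ {C D} → C ≈ D → IsBNC C → IsBNC D
isBNC-≈ {D = mkBNC _ _} (refl , f) (1≤n , unit , big) =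
  1≤n , (λ n≡1 → trans (sym (f 0 1 z<s (≤-reflexive (sym n≡1)))) (unit n≡1)) ,
  λ 2≤n → redDiagonals-agree f (proj₁ (big 2≤n)) , noCrossing-agree f (proj₂ (big 2≤n))

inGen⇒isBNC : ∀ C → InGen C → IsBNC C
inGen⇒isBNC C C∈ with inGen⇒image C C∈
... | t , πt≈C = isBNC-≈ πt≈C (isBNC-π t)

flipGen : Gen → Gen
flipGen α = β
flipGen β = α

combine : Gen → Tree → Tree → Tree
combine g (node β X (node α Y Z)) W = node g X (node (flipGen g) Y (combine g Z W))
combine g L W = node g L W

nf : Tree → Tree
nf leaf = leaf
nf (node g l r) = combine g (nf l) (nf r)

node-cong : ∀ g {l l′ r r′} → l ≡F l′ → r ≡F r′ → node g l r ≡F node g l′ r′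
node-cong g l≡l′ r≡r′ = cg-comp 0 z<s (cg-comp 1 (s≤s (s≤s z≤n)) (cg-refl {gt g}) r≡r′) l≡l′

relation : ∀ g → graft (graft (gt g) 1 (gt (flipGen g))) 2 (gt g) ≡F graft (graft (gt g) 0 (gt β)) 1 (gt α)
relation α = cg-rel₂
relation β = cg-rel₁

-- X, Y, Z, W are grafted from the right so that the leaf indices do not shift.
rewrite-step : ∀ g X Y Z W → node g (node β X (node α Y Z)) W ≡F node g X (node (flipGen g) Y (node g Z W))
rewrite-step g X Y Z W =
  cg-sym (cg-comp 0 z<s (cg-comp 1 (s≤s (s≤s z≤n)) (cg-comp 2 (s≤s (s≤s (s≤s z≤n)))
    (cg-comp 3 (s≤s (s≤s (s≤s (s≤s z≤n)))) (relation g) (cg-refl {W})) (cg-refl {Z})) (cg-refl {Y})) (cg-refl {X}))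

combine-≡F : ∀ g L W → node g L W ≡F combine g L W
combine-≡F g (node β X (node α Y Z)) W =
  cg-trans (rewrite-step g X Y Z W) (node-cong g cg-refl (node-cong (flipGen g) cg-refl (combine-≡F g Z W)))
combine-≡F g leaf W = cg-refl
combine-≡F g (node α _ _) W = cg-refl
combine-≡F g (node β _ leaf) W = cg-refl
combine-≡F g (node β _ (node β _ _)) W = cg-refl

nf-≡F : ∀ t → t ≡F nf t
nf-≡F leaf = cg-refl
nf-≡F (node g l r) = cg-trans (node-cong g (nf-≡F l) (nf-≡F r)) (combine-≡F g (nf l) (nf r))

mutual
  data Normal : Tree → Set where
    nf-leaf : Normal leaf
    nf-node : ∀ {g l r} → NormalLeft l → Normal r → Normal (node g l r)

  data NormalLeft : Tree → Set where
    nfl-leaf   : NormalLeft leaf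
    nfl-α      : ∀ {l r} → NormalLeft l → Normal r → NormalLeft (node α l r)
    nfl-β-leaf : ∀ {l} → NormalLeft l → NormalLeft (node β l leaf)
    nfl-β-β    : ∀ {l x y} → NormalLeft l → Normal (node β x y) → NormalLeft (node β l (node β x y))

normalLeft⇒normal : ∀ {t} → NormalLeft t → Normal t
normalLeft⇒normal nfl-leaf = nf-leaf
normalLeft⇒normal (nfl-α l r) = nf-node l r
normalLeft⇒normal (nfl-β-leaf l) = nf-node l nf-leaf
normalLeft⇒normal (nfl-β-β l r) = nf-node l r

combine-normal : ∀ g {L W} → Normal L → Normal W → Normal (combine g L W)
combine-normal g {node β X (node α Y Z)} (nf-node X′ (nf-node Y′ Z′)) W′ =
  nf-node X′ (nf-node Y′ (combine-normal g Z′ W′))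
combine-normal g {leaf} _ W′ = nf-node nfl-leaf W′
combine-normal g {node α _ _} (nf-node l r) W′ = nf-node (nfl-α l r) W′
combine-normal g {node β _ leaf} (nf-node l _) W′ = nf-node (nfl-β-leaf l) W′
combine-normal g {node β _ (node β _ _)} (nf-node l r) W′ = nf-node (nfl-β-β l r) W′

nf-normal : ∀ t → Normal (nf t)
nf-normal leaf = nf-leaf
nf-normal (node g l r) = combine-normal g (nf-normal l) (nf-normal r)

Cut : ℕ → Colouring → ℕ → Set
Cut n c v = ∀ p q → p < v → v < q → q ≤ n → ¬ (p ≡ 0 × q ≡ n) → c p q ≡ none

CutOf : Tree → ℕ → Set
CutOf t = Cut (arity t) (col (π t))

record NextCut (n : ℕ) (c : Colouring) (v w : ℕ) : Set where
  field
    v<w            : v < w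
    w≤n            : w ≤ n
    end-or-cut     : w ≡ n ⊎ Cut n c w
    no-cut-between : ∀ u → v < u → u < w → ¬ Cut n c u

record SplitPoint (n : ℕ) (c : Colouring) (v : ℕ) : Set where
  field
    0<v         : 0 < v
    v<n         : v < n
    cut         : Cut n c v
    next        : ℕ
    next-cut    : NextCut n c v next
    blue-or-end : c v next ≡ blue ⊎ next ≡ n

cut-agree : ∀ {n c c′ v} → Agree n c c′ → Cut n c v → Cut n c′ v
cut-agree f cut p q p<v v<q q≤n nb = trans (sym (f p q (<-trans p<v v<q) q≤n)) (cut p q p<v v<q q≤n nb)

splitPoint-agree : ∀ {n c c′ v} → Agree n c c′ → SplitPoint n c v → SplitPoint n c′ v
splitPoint-agree f sp = record
  { 0<v = 0<v ; v<n = v<n ; cut = cut-agree f cut ; next = next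
  ; next-cut = record
    { v<w = v<w ; w≤n = w≤n
    ; end-or-cut = map₂ (cut-agree f) end-or-cut
    ; no-cut-between = λ u v<u u<w → no-cut-between u v<u u<w ∘ cut-agree (λ p q p<q q≤n → sym (f p q p<q q≤n)) }
  ; blue-or-end = map₁ (trans (sym (f _ next v<w w≤n))) blue-or-end }
  where
  open SplitPoint sp
  open NextCut next-cut

module NodeCut (g : Gen) (l r : Tree) where
  open NodeColour g l r

  t : Tree
  t = node g l r

  left-base-colour : ct 0 a ≡ glue blue (baseColour l)
  left-base-colour = trans col-left-base (cong (glue blue) (col-π-base l))

  right-base-colour : ct a n ≡ glue (genColour g) (baseColour r)
  right-base-colour = trans col-right-base (cong (glue (genColour g)) (col-π-base r))

  cut-left : ∀ {v} → CutOf t v → v < a → CutOf l v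
  cut-left cut v<a p q p<v v<q q≤a nb =
    trans (sym (col-left (<-trans p<v v<q) q≤a nb))
          (cut p q p<v v<q (≤-trans q≤a (<⇒≤ a<n)) (λ (_ , q≡n) → <⇒≱ (≤-<-trans q≤a a<n) (≤-reflexive (sym q≡n))))

  cut-from-left : ∀ {v} → CutOf l v → ct 0 a ≡ none → v < a → CutOf t v
  cut-from-left {v} cut left-base≡none v<a p q p<v v<q q≤n nb with nodeArcPosition a n p q
  ... | in-left q≤a nb′ = trans (col-left (<-trans p<v v<q) q≤a nb′) (cut p q p<v v<q q≤a nb′)
  ... | left-base refl refl = left-base≡none
  ... | in-right a≤p _ = ⊥-elim (<⇒≱ (<-trans p<v v<a) a≤p)
  ... | right-base p≡a _ = ⊥-elim (<-irrefl p≡a (<-trans p<v v<a))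
  ... | root-base p≡0 q≡n = ⊥-elim (nb (p≡0 , q≡n))
  ... | crossing p<a a<q nb′ = col-crossing p<a a<q q≤n nb′

  cut-right : ∀ {v} → CutOf t (a + v) → CutOf r v
  cut-right cut p q p<v v<q q≤ nb = trans (sym (col-right-shifted (<-trans p<v v<q) q≤ nb))
    (cut (a + p) (a + q) (+-monoʳ-< a p<v) (+-monoʳ-< a v<q) (+-monoʳ-≤ a q≤)
         (λ (a+p≡0 , _) → <-irrefl (sym a+p≡0) (<-≤-trans 0<a (m≤m+n a p))))

  cut-from-right : ∀ {v} → CutOf r v → ct a n ≡ none → 0 < v → CutOf t (a + v)
  cut-from-right {v} cut right-base≡none 0<v p q p<a+v a+v<q q≤n nb with nodeArcPosition a n p q
  ... | in-left q≤a _ = ⊥-elim (<⇒≱ (<-trans (m<m+n a 0<v) a+v<q) q≤a)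
  ... | left-base _ q≡a = ⊥-elim (<⇒≱ (<-trans (m<m+n a 0<v) a+v<q) (≤-reflexive q≡a))
  ... | in-right a≤p nb′ = trans (col-right (<-trans p<a+v a+v<q) a≤p q≤n nb′)
    (cut (p ∸ a) (q ∸ a) (n≤m⇒m<n+o⇒m∸n<o a≤p p<a+v) (m+n<o⇒n<o∸m {a} a+v<q) (m≤n+o⇒m∸n≤o q a q≤n)
         (λ (p∸a≡0 , q∸a≡) → nb′ (trans (n≤m⇒m∸n≡o⇒m≡n+o a≤p p∸a≡0) (+-identityʳ a) ,
                                  n≤m⇒m∸n≡o⇒m≡n+o (≤-trans a≤p (<⇒≤ (<-trans p<a+v a+v<q))) q∸a≡)))
  ... | right-base refl refl = right-base≡none
  ... | root-base p≡0 q≡n = ⊥-elim (nb (p≡0 , q≡n))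
  ... | crossing p<a a<q nb′ = col-crossing p<a a<q q≤n nb′

  cut-root : CutOf t a
  cut-root p q p<a a<q q≤n nb = col-crossing p<a a<q q≤n nb

  no-cut-under-left-base : ∀ {v} → ct 0 a ≢ none → 0 < v → v < a → ¬ CutOf t v
  no-cut-under-left-base left-base≢none 0<v v<a cut =
    left-base≢none (cut 0 a 0<v v<a (<⇒≤ a<n) (λ (_ , a≡n) → <-irrefl a≡n a<n))

  no-cut-under-right-base : ∀ {v} → ct a n ≢ none → a < v → v < n → ¬ CutOf t v
  no-cut-under-right-base right-base≢none a<v v<n cut =
    right-base≢none (cut a n a<v v<n ≤-refl (λ (a≡0 , _) → <-irrefl (sym a≡0) 0<a))

  nextCut-left : ∀ {v w} → ct 0 a ≡ none → v < a → NextCut n ct v w → NextCut a (col (π l)) v w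
  nextCut-left {v} {w} left-base≡none v<a next = record
    { v<w = v<w ; w≤n = w≤a
    ; end-or-cut = end-or-cut′
    ; no-cut-between = λ u v<u u<w cut →
        no-cut-between u v<u u<w (cut-from-left cut left-base≡none (<-≤-trans u<w w≤a)) }
    where
    open NextCut next
    w≤a : w ≤ a
    w≤a with w ≤? a
    ... | yes w≤a = w≤a
    ... | no w≰a = ⊥-elim (no-cut-between a v<a (≰⇒> w≰a) cut-root)
    end-or-cut′ : w ≡ a ⊎ CutOf l w
    end-or-cut′ with w ≟ a | end-or-cut
    ... | yes w≡a | _ = inj₁ w≡a
    ... | no _ | inj₁ w≡n = ⊥-elim (<⇒≱ (≤-<-trans w≤a a<n) (≤-reflexive (sym w≡n)))
    ... | no w≢a | inj₂ cut = inj₂ (cut-left cut (≤∧≢⇒< w≤a w≢a))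

record FirstCut (t : Tree) : Set where
  field
    f     : ℕ
    0<f   : 0 < f
    f<n   : f < arity t
    cut   : CutOf t f
    least : ∀ u → 0 < u → u < f → ¬ CutOf t u
    blue-arc : col (π t) 0 f ≡ blue

blue≢none : blue ≢ none
blue≢none ()

firstCut-root : ∀ g l r → baseColour l ≡ blue → FirstCut (node g l r)
firstCut-root g l r base-blue = record
  { f = a ; 0<f = 0<a ; f<n = a<n ; cut = cut-root
  ; least = λ u 0<u u<a → no-cut-under-left-base (blue≢none ∘ trans (sym left-base-blue)) 0<u u<a
  ; blue-arc = left-base-blue }
  where
  open NodeColour g l r
  open NodeCut g l r
  left-base-blue : ct 0 a ≡ blue
  left-base-blue = trans left-base-colour (cong (glue blue) base-blue)

firstCut : ∀ g l r → FirstCut (node g l r)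
firstCut g leaf r = firstCut-root g leaf r refl
firstCut g (node α l₁ l₂) r = firstCut-root g (node α l₁ l₂) r refl
firstCut g (node β l₁ l₂) r = record
  { f = f ; 0<f = 0<f ; f<n = <-trans f<n a<n ; cut = cut-from-left cut left-base-colour f<n
  ; least = λ u 0<u u<f cut′ → least u 0<u u<f (cut-left cut′ (<-trans u<f f<n))
  ; blue-arc = trans (col-left 0<f (<⇒≤ f<n) (λ (_ , f≡a) → <-irrefl f≡a f<n)) blue-arc }
  where
  open NodeColour g (node β l₁ l₂) r
  open NodeCut g (node β l₁ l₂) r
  open FirstCut (firstCut β l₁ l₂)

glue-noneˡ≢blue : ∀ x → glue none x ≢ blue
glue-noneˡ≢blue blue ()
glue-noneˡ≢blue red ()
glue-noneˡ≢blue none ()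

red≢none : red ≢ none
red≢none ()

no-cut-right-of-β : ∀ {l₁ l₂} → NormalLeft (node β l₁ l₂) →
                    ∀ {w} → arity l₁ < w → w < arity l₁ + arity l₂ → ¬ CutOf (node β l₁ l₂) w
no-cut-right-of-β {l₁} (nfl-β-leaf _) {w} a<w w<n _ = <⇒≱ a<w (≤-pred (subst (w <_) (+-comm (arity l₁) 1) w<n))
no-cut-right-of-β {l₁} {node β x y} (nfl-β-β _ _) =
  no-cut-under-right-base (red≢none ∘ trans (sym right-base-colour))
  where open NodeCut β l₁ (node β x y)

mutual
  nextCut-not-blue : ∀ g l r → NormalLeft l → ∀ {v w} → 0 < v → v < arity l → CutOf (node g l r) v →
                     NextCut (arity (node g l r)) (col (π (node g l r))) v w → col (π (node g l r)) v w ≢ blue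
  nextCut-not-blue g leaf r _ 0<v v<1 = ⊥-elim (<⇒≱ 0<v (≤-pred v<1))
  nextCut-not-blue g (node α l₁ l₂) r _ 0<v v<a cut =
    ⊥-elim (no-cut-under-left-base (blue≢none ∘ trans (sym left-base-colour)) 0<v v<a cut)
    where open NodeCut g (node α l₁ l₂) r
  nextCut-not-blue g (node β l₁ l₂) r nl 0<v v<a cut next ct≡blue =
    β-nextCut-not-blue nl 0<v v<a (cut-left cut v<a) next′ (trans (sym (col-left v<w w≤a not-base)) ct≡blue)
    where
    open NodeColour g (node β l₁ l₂) r
    open NodeCut g (node β l₁ l₂) r
    next′ = nextCut-left left-base-colour v<a next
    open NextCut next′ renaming (w≤n to w≤a)
    not-base : ¬ (_ ≡ 0 × _ ≡ a)
    not-base (v≡0 , _) = <-irrefl (sym v≡0) 0<v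

  β-nextCut-not-blue : ∀ {l₁ l₂} → NormalLeft (node β l₁ l₂) → ∀ {v w} → 0 < v → v < arity (node β l₁ l₂) →
                       CutOf (node β l₁ l₂) v → NextCut (arity (node β l₁ l₂)) (col (π (node β l₁ l₂))) v w →
                       col (π (node β l₁ l₂)) v w ≢ blue
  β-nextCut-not-blue {l₁} {l₂} nl {v} {w} 0<v v<n cut next with <-cmp v (arity l₁)
  ... | tri< v<a _ _ = nextCut-not-blue β l₁ l₂ (left-of nl) 0<v v<a cut next
    where
    left-of : NormalLeft (node β l₁ l₂) → NormalLeft l₁
    left-of (nfl-β-leaf nl₁) = nl₁
    left-of (nfl-β-β nl₁ _) = nl₁
  ... | tri> _ _ a<v = ⊥-elim (no-cut-right-of-β nl a<v v<n cut)
  ... | tri≈ _ refl _ = glue-noneˡ≢blue _ ∘ trans (sym right-base-colour) ∘ subst (λ x → ct a x ≡ blue) w≡n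
    where
    open NodeColour β l₁ l₂
    open NodeCut β l₁ l₂
    open NextCut next
    w≡n : w ≡ n
    w≡n with end-or-cut | m≤n⇒m<n∨m≡n w≤n
    ... | inj₁ w≡n | _ = w≡n
    ... | inj₂ _ | inj₂ w≡n = w≡n
    ... | inj₂ cut-w | inj₁ w<n = ⊥-elim (no-cut-right-of-β nl v<w w<n cut-w)

splitPoint-root : ∀ g l r → SplitPoint (arity (node g l r)) (col (π (node g l r))) (arity l)
splitPoint-root g l r with ct a n ≟ᶜ none
  where open NodeColour g l r
... | no right-base≢none = record
  { 0<v = 0<a ; v<n = a<n ; cut = cut-root ; next = n
  ; next-cut = record { v<w = a<n ; w≤n = ≤-refl ; end-or-cut = inj₁ refl
                      ; no-cut-between = λ u a<u u<n → no-cut-under-right-base right-base≢none a<u u<n }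
  ; blue-or-end = inj₂ refl }
  where
  open NodeColour g l r
  open NodeCut g l r
splitPoint-root g l leaf | yes _ = record
  { 0<v = 0<a ; v<n = a<n ; cut = cut-root ; next = n
  ; next-cut = record { v<w = a<n ; w≤n = ≤-refl ; end-or-cut = inj₁ refl
                      ; no-cut-between = λ u a<u u<n _ → <⇒≱ a<u (≤-pred (subst (u <_) (+-comm a 1) u<n)) }
  ; blue-or-end = inj₂ refl }
  where
  open NodeColour g l leaf
  open NodeCut g l leaf
splitPoint-root g l (node g′ r₁ r₂) | yes right-base≡none = record
  { 0<v = 0<a ; v<n = a<n ; cut = cut-root ; next = a + f
  ; next-cut = record
    { v<w = m<m+n a 0<f ; w≤n = +-monoʳ-≤ a (<⇒≤ f<n)
    ; end-or-cut = inj₂ (cut-from-right cut right-base≡none 0<f)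
    ; no-cut-between = λ u a<u u<a+f cut-u →
        least (u ∸ a) (m<n⇒0<n∸m a<u) (n≤m⇒m<n+o⇒m∸n<o (<⇒≤ a<u) u<a+f)
              (cut-right (subst (CutOf (node g l (node g′ r₁ r₂))) (sym (m+[n∸m]≡n (<⇒≤ a<u))) cut-u)) }
  ; blue-or-end = inj₁ (trans (subst (λ x → ct x (a + f) ≡ col (π (node g′ r₁ r₂)) 0 f) (+-identityʳ a)
                                     (col-right-shifted 0<f (<⇒≤ f<n) (λ (_ , f≡) → <-irrefl f≡ f<n)))
                              blue-arc) }
  where
  open NodeColour g l (node g′ r₁ r₂)
  open NodeCut g l (node g′ r₁ r₂)
  open FirstCut (firstCut g′ r₁ r₂)

no-splitPoint-below : ∀ g l r → NormalLeft l → ∀ {v} → v < arity l →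
                      ¬ SplitPoint (arity (node g l r)) (col (π (node g l r))) v
no-splitPoint-below g l r nl v<a sp with SplitPoint.blue-or-end sp
... | inj₁ is-blue = nextCut-not-blue g l r nl 0<v v<a cut next-cut is-blue
  where open SplitPoint sp
... | inj₂ next≡n = no-cut-between (arity l) v<a (subst (arity l <_) (sym next≡n) a<n) cut-root
  where
  open NodeColour g l r using (a<n)
  open NodeCut g l r using (cut-root)
  open SplitPoint sp
  open NextCut next-cut

glue-injective : ∀ z {x y} → z ≢ red → x ≢ red → y ≢ red → glue z x ≡ glue z y → x ≡ y
glue-injective blue {blue} {blue} _ _ _ _ = refl
glue-injective blue {none} {none} _ _ _ _ = refl
glue-injective none {blue} {blue} _ _ _ _ = refl
glue-injective none {none} {none} _ _ _ _ = refl
glue-injective blue {blue} {none} _ _ _ ()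
glue-injective blue {none} {blue} _ _ _ ()
glue-injective none {blue} {none} _ _ _ ()
glue-injective none {none} {blue} _ _ _ ()
glue-injective red z≢red _ _ _ = ⊥-elim (z≢red refl)
glue-injective _ {red} _ x≢red _ _ = ⊥-elim (x≢red refl)
glue-injective _ {_} {red} _ _ y≢red _ = ⊥-elim (y≢red refl)

genColour-injective : ∀ {g g′} → genColour g ≡ genColour g′ → g ≡ g′
genColour-injective {α} {α} _ = refl
genColour-injective {β} {β} _ = refl
genColour-injective {α} {β} ()
genColour-injective {β} {α} ()

π-≈⇒agree : ∀ s t → π s ≈ π t → arity s ≡ arity t × Agree (arity s) (col (π s)) (col (π t))
π-≈⇒agree s t (size≡ , f) =
  trans (sym (size-π s)) (trans size≡ (size-π t)) ,
  λ p q p<q q≤ → f p q p<q (≤-trans q≤ (≤-reflexive (sym (size-π s))))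

splitPoint-≈ : ∀ s t {v} → π s ≈ π t → SplitPoint (arity s) (col (π s)) v → SplitPoint (arity t) (col (π t)) v
splitPoint-≈ s t {v} e sp with π-≈⇒agree s t e
... | arity≡ , f = subst (λ n → SplitPoint n (col (π t)) v) arity≡ (splitPoint-agree f sp)

root-≡ : ∀ {g l r g′ l′ r′} → π (node g l r) ≈ π (node g′ l′ r′) → g ≡ g′
root-≡ {g} {l} {r} {g′} {l′} {r′} e with π-≈⇒agree (node g l r) (node g′ l′ r′) e
... | n≡n′ , f = genColour-injective (begin
  genColour g                    ≡⟨ S.col-base ⟨
  S.ct 0 S.n                     ≡⟨ f 0 S.n (<-trans S.0<a S.a<n) ≤-refl ⟩
  T.ct 0 S.n                     ≡⟨ cong (T.ct 0) n≡n′ ⟩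
  T.ct 0 T.n                     ≡⟨ T.col-base ⟩
  genColour g′                   ∎)
  where
  open ≡-Reasoning
  module S = NodeColour g l r
  module T = NodeColour g′ l′ r′

left-arity-≡ : ∀ {g l r g′ l′ r′} → NormalLeft l → NormalLeft l′ → π (node g l r) ≈ π (node g′ l′ r′) →
               arity l ≡ arity l′
left-arity-≡ {g} {l} {r} {g′} {l′} {r′} nl nl′ e with <-cmp (arity l) (arity l′)
... | tri< a<a′ _ _ =
  ⊥-elim (no-splitPoint-below g′ l′ r′ nl′ a<a′ (splitPoint-≈ (node g l r) (node g′ l′ r′) e (splitPoint-root g l r)))
... | tri≈ _ a≡a′ _ = a≡a′
... | tri> _ _ a′<a =
  ⊥-elim (no-splitPoint-below g l r nl a′<a (splitPoint-≈ (node g′ l′ r′) (node g l r) (≈-sym e) (splitPoint-root g′ l′ r′)))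

module SameRoot (g : Gen) (l r l′ r′ : Tree) (e : π (node g l r) ≈ π (node g l′ r′)) (a≡a′ : arity l ≡ arity l′)
  where
  private
    module S = NodeColour g l r
    module T = NodeColour g l′ r′
    open ≡-Reasoning

    f : Agree S.n S.ct T.ct
    f = proj₂ (π-≈⇒agree (node g l r) (node g l′ r′) e)

    n≡n′ : S.n ≡ T.n
    n≡n′ = proj₁ (π-≈⇒agree (node g l r) (node g l′ r′) e)

    r≡r′ : arity r ≡ arity r′
    r≡r′ = +-cancelˡ-≡ (arity l) _ _ (trans n≡n′ (cong (_+ arity r′) (sym a≡a′)))

    base≢red : ∀ u u′ → arity u ≡ arity u′ → col (π u′) 0 (arity u) ≢ red
    base≢red _ u′ a≡ = subst (λ x → col (π u′) 0 x ≢ red) (sym a≡) (col-π-base≢red u′)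

  π-left-≈ : π l ≈ π l′
  π-left-≈ = trans (size-π l) (trans a≡a′ (sym (size-π l′))) , agree
    where
    agree : Agree (size (π l)) (col (π l)) (col (π l′))
    agree p q p<q q≤ with p ≟ 0 ×-dec q ≟ arity l
    ... | yes (refl , refl) = glue-injective blue (λ ()) (col-π-base≢red l) (base≢red l l′ a≡a′) (begin
      glue blue (col (π l) 0 (arity l))     ≡⟨ S.col-left-base ⟨
      S.ct 0 (arity l)                      ≡⟨ f 0 (arity l) S.0<a (<⇒≤ S.a<n) ⟩
      T.ct 0 (arity l)                      ≡⟨ cong (T.ct 0) a≡a′ ⟩
      T.ct 0 (arity l′)                     ≡⟨ T.col-left-base ⟩
      glue blue (col (π l′) 0 (arity l′))   ≡⟨ cong (λ x → glue blue (col (π l′) 0 x)) a≡a′ ⟨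
      glue blue (col (π l′) 0 (arity l))    ∎)
    ... | no nb = begin
      col (π l) p q  ≡⟨ S.col-left p<q q≤a nb ⟨
      S.ct p q       ≡⟨ f p q p<q (≤-trans q≤a (<⇒≤ S.a<n)) ⟩
      T.ct p q       ≡⟨ T.col-left p<q (≤-trans q≤a (≤-reflexive a≡a′))
                                     (λ (p≡0 , q≡) → nb (p≡0 , trans q≡ (sym a≡a′))) ⟩
      col (π l′) p q ∎
      where
      q≤a : q ≤ arity l
      q≤a = ≤-trans q≤ (≤-reflexive (size-π l))

  π-right-≈ : π r ≈ π r′
  π-right-≈ = trans (size-π r) (trans r≡r′ (sym (size-π r′))) , agree
    where
    agree : Agree (size (π r)) (col (π r)) (col (π r′))
    agree p q p<q q≤ with p ≟ 0 ×-dec q ≟ arity r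
    ... | yes (refl , refl) =
      glue-injective (genColour g) (genColour≢red g) (col-π-base≢red r) (base≢red r r′ r≡r′) (begin
      glue (genColour g) (col (π r) 0 (arity r))   ≡⟨ S.col-right-base ⟨
      S.ct (arity l) S.n                           ≡⟨ f (arity l) S.n S.a<n ≤-refl ⟩
      T.ct (arity l) S.n                           ≡⟨ cong₂ T.ct a≡a′ n≡n′ ⟩
      T.ct (arity l′) T.n                          ≡⟨ T.col-right-base ⟩
      glue (genColour g) (col (π r′) 0 (arity r′))
                                                   ≡⟨ cong (λ x → glue (genColour g) (col (π r′) 0 x)) r≡r′ ⟨
      glue (genColour g) (col (π r′) 0 (arity r))  ∎)
    ... | no nb = begin
      col (π r) p q                    ≡⟨ S.col-right-shifted p<q q≤r nb ⟨
      S.ct (arity l + p) (arity l + q) ≡⟨ f _ _ (+-monoʳ-< (arity l) p<q) (+-monoʳ-≤ (arity l) q≤r) ⟩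
      T.ct (arity l + p) (arity l + q) ≡⟨ cong₂ T.ct (cong (_+ p) a≡a′) (cong (_+ q) a≡a′) ⟩
      T.ct (arity l′ + p) (arity l′ + q) ≡⟨ T.col-right-shifted p<q (≤-trans q≤r (≤-reflexive r≡r′))
                                             (λ (p≡0 , q≡) → nb (p≡0 , trans q≡ (sym r≡r′))) ⟩
      col (π r′) p q                   ∎
      where
      q≤r : q ≤ arity r
      q≤r = ≤-trans q≤ (≤-reflexive (size-π r))

π-injective : ∀ {s t} → Normal s → Normal t → π s ≈ π t → s ≡ t
π-injective nf-leaf nf-leaf _ = refl
π-injective nf-leaf (nf-node {g} {l} {r} _ _) e =
  ⊥-elim (<⇒≱ (2≤arity-node g l r) (≤-reflexive (sym (proj₁ (π-≈⇒agree leaf (node g l r) e)))))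
π-injective (nf-node {g} {l} {r} _ _) nf-leaf e =
  ⊥-elim (<⇒≱ (2≤arity-node g l r) (≤-reflexive (proj₁ (π-≈⇒agree (node g l r) leaf e))))
π-injective (nf-node {g} {l} {r} nl nr) (nf-node {g′} {l′} {r′} nl′ nr′) e with root-≡ {g} {l} {r} {g′} {l′} {r′} e
... | refl = cong₂ (node g) (π-injective (normalLeft⇒normal nl) (normalLeft⇒normal nl′) π-left-≈)
                            (π-injective nr nr′ π-right-≈)
  where open SameRoot g l r l′ r′ e (left-arity-≡ {g} {l} {r} {g} {l′} {r′} nl nl′ e)

π-reflects-≡F : ∀ s t → π s ≈ π t → s ≡F t
π-reflects-≡F s t πs≈πt = cg-trans (nf-≡F s) (subst (_≡F t) (sym nf-s≡nf-t) (cg-sym (nf-≡F t)))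
  where
  π-nf : ∀ u → π (nf u) ≈ π u
  π-nf u = π-resp-≡F (cg-sym (nf-≡F u))
  nf-s≡nf-t : nf s ≡ nf t
  nf-s≡nf-t = π-injective (nf-normal s) (nf-normal t) (≈-trans (π-nf s) (≈-trans πs≈πt (≈-sym (π-nf t))))

mainTheorem11 :
    -- the suboperad ⟨τaaa, τabb⟩ consists of genuine BNCs (lies in CNCB)
    (∀ C → InGen C → IsBNC C)
    -- π lands in ⟨τaaa, τabb⟩
    × (∀ t → InGen (π t))
    -- π is onto ⟨τaaa, τabb⟩
    × (∀ C → InGen C → Σ Tree (λ t → π t ≈ C))
    -- π is constant on ≡-classes and injective on them
    × (∀ s t → s ≡F t → π s ≈ π t)
    × (∀ s t → π s ≈ π t → s ≡F t)
mainTheorem11 = inGen⇒isBNC , inGen-π , inGen⇒image , (λ _ _ → π-resp-≡F) , π-reflects-≡F
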